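{- Fix $n$ and $p$ with $0\le p\le n/2$, and let $q>0$ be such that $\Delta_k(q)\ne 0$ for $0\le k\le n$. For every half-diagram $\mathfrak{a}$ on $n$ points with $p$ pairs, when $\xi'_{\mathfrak{a}}$ is written in the basis $\{\xi_{\mathfrak{b}}\}$ of $U(n)$, the coefficient of $\xi_{\mathfrak{a}}$ is $1$.
   Context: Temperley–Lieb algebra: $TL_n$ is the complex vector space with basis $e_{\mathfrak{p}}$ indexed by noncrossing pairings $\mathfrak{p}$ of $\{1,\dots,2n\}$, drawn with points $1,\dots,n$ top to bottom on the left of a rectangle and $n+1,\dots,2n$ bottom to top on the right. The generator $e_i$ ($1\le i\le n-1$) pairs $i$ with $i+1$, $2n-i+1$ with $2n-i$, and every other $j\le n$ with $2n-j+1$. Half-diagrams: a half-diagram on $n$ points is a noncrossing partition of $\{1,\dots,n\}$ into pairs and singletons (singletons carry through-strings; noncrossing means no $i<k<j<l$ with $i\sim j,k\sim l$ and no $i<k<j$ with $i\sim j$, $k$ a singleton). $U(n)$ has basis $\xi_{\mathfrak{a}}$ over half-diagrams. $TL_n$ acts on $U(n)$: for a pairing $\mathfrak{p}$ and half-diagram $\mathfrak{a}$, identify point $i$ of $\mathfrak{a}$ with point $2n-i+1$ of $\mathfrak{p}$; if an edge path joins two through-strings of $\mathfrak{a}$ the result is $0$; otherwise $e_{\mathfrak{p}}\xi_{\mathfrak{a}}=q^c\xi_{\mathfrak{b}}$ where $c$ is the number of closed loops and $\mathfrak{b}$ is the half-diagram induced on points $1,\dots,n$ of $\mathfrak{p}$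 by following edge paths (a point joined to a through-string of $\mathfrak{a}$ carries a through-string). Heights: $h_0(\mathfrak{a})=0$, $h_i(\mathfrak{a})$ = #$\{j\le i$: $j$ a through-string or paired with a larger point$\}$ − #$\{j\le i$: $j$ paired with a smaller point$\}$; a half-diagram is determined by its heights. $\mathfrak{a}$ has a minimum at $i$ ($1\le i\le n-1$) if $h_{i-1}(\mathfrak{a})>h_i(\mathfrak{a})<h_{i+1}(\mathfrak{a})$; then $\Diamond_i(\mathfrak{a})$ is the half-diagram with the same heights except $h_i$ increased by $2$. Chebyshev polynomials: $\Delta_{ -1}=0$, $\Delta_0=1$, $\Delta_{k+1}(q)=q\Delta_k(q)-\Delta_{k-1}(q)$; $\mu_k=\Delta_{k-1}(q)/\Delta_k(q)$. Second basis: the minimal element $(1,\dots,1)$ with $p$ pairs is the half-diagram with pairs $\{1,2\},\dots,\{2p-1,2p\}$ and through-strings at $2p+1,\dots,n$; every half-diagram with $p$ pairs arises from it by a finite sequence of box additions. Set $\xi'_{(1,\dots,1)}=\xi_{(1,\dots,1)}$ and, whenever $\mathfrak{a}$ has a minimum at $i$, $\xi'_{\Diamond_i(\mathfrak{a})}=(e_i-\mu_{h_i(\mathfrak{a})+1})\xi'_{\mathfrak{a}}$ (independent of the chosen sequence of box additions). -}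

module Defs where

open import Level using (_⊔_)
open import Data.Nat as ℕ using (ℕ; zero; suc; _∸_; _≤_; _<_; _<ᵇ_)
import Data.Nat.Properties as ℕP
open import Data.Integer as ℤ using (ℤ; +_; ∣_∣)
open import Data.Bool using (Bool; true; false; if_then_else_)
open import Data.Maybe using (Maybe; just; nothing)
import Data.Maybe.Properties as MaybeP
open import Data.List using (List; []; _∷_; _++_; map; concatMap; foldr; upTo)
import Data.List.Properties as ListP
open import Data.Product using (_×_; _,_)
open import Data.Empty using (⊥)
open import Relation.Nullary using (¬_; yes; no)
open import Relation.Binary.PropositionalEquality using (_≡_; _≢_)
open import Relation.Binary.Definitions using (DecidableEquality)
open import Algebra.Bundles using (CommutativeRing)

-- A (raw) diagram is a list d of length n; its j-th entry (points are
-- numbered 1..n, as in the paper) is  just k  if point j is paired with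
-- point k, and  nothing  if point j carries a through-string.

Raw : Set
Raw = List (Maybe ℕ)

-- partner of point j (1-based); out-of-range points give nothing
at : Raw → ℕ → Maybe ℕ
at []       _             = nothing
at (x ∷ xs) zero          = nothing
at (x ∷ xs) (suc zero)    = x
at (x ∷ xs) (suc (suc k)) = at xs (suc k)

upd : Raw → ℕ → Maybe ℕ → Raw
upd []       _             v = []
upd (x ∷ xs) zero          v = x ∷ xs
upd (x ∷ xs) (suc zero)    v = v ∷ xs
upd (x ∷ xs) (suc (suc k)) v = x ∷ upd xs (suc k) v

_≟R_ : DecidableEquality Raw
_≟R_ = ListP.≡-dec (MaybeP.≡-dec ℕ._≟_)

record HalfDiagram (n : ℕ) (d : Raw) : Set where
  field
    len        : Data.List.length d ≡ n
    pairing    : ∀ i j → at d i ≡ just j →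
                 (1 ≤ j) × (j ≤ n) × (j ≢ i) × (at d j ≡ just i)
    noncross   : ∀ i j k l → at d i ≡ just j → at d k ≡ just l →
                 i < k → k < j → j < l → ⊥
    noncrossTS : ∀ i j k → at d i ≡ just j → i < k → k < j →
                 at d k ≡ nothing → ⊥

stepVal : ℕ → Maybe ℕ → ℤ
stepVal j nothing  = + 1
stepVal j (just k) = if j <ᵇ k then + 1 else ℤ.- (+ 1)

height : Raw → ℕ → ℤ
height d zero    = + 0
height d (suc i) = height d i ℤ.+ stepVal (suc i) (at d (suc i))

pairsUpTo : Raw → ℕ → ℕ
pairsUpTo d zero    = 0
pairsUpTo d (suc i) = pairsUpTo d i ℕ.+ opener (at d (suc i))
  where
  opener : Maybe ℕ → ℕ
  opener nothing  = 0
  opener (just k) = if suc i <ᵇ k then 1 else 0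

numPairs : ℕ → Raw → ℕ
numPairs n d = pairsUpTo d n

MinAt : ℕ → Raw → ℕ → Set
MinAt n d i = (1 ≤ i) × (i < n) ×
              (height d i ℤ.< height d (i ∸ 1)) × (height d i ℤ.< height d (suc i))

IsDiamond : ℕ → ℕ → Raw → Raw → Set
IsDiamond n i a b = HalfDiagram n b ×
                    (height b i ≡ height a i ℤ.+ + 2) ×
                    (∀ j → j ≤ n → j ≢ i → height b j ≡ height a j)

-- the minimal element (1,...,1) with p pairs:
-- pairs {1,2},...,{2p-1,2p}, through-strings at 2p+1,...,n
pairMate : ℕ → ℕ
pairMate zero                = 0
pairMate (suc zero)          = 2
pairMate (suc (suc zero))    = 1
pairMate (suc (suc (suc k))) = 2 ℕ.+ pairMate (suc k)

minEntry : ℕ → ℕ → Maybe ℕ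
minEntry p j = if j <ᵇ suc (2 ℕ.* p) then just (pairMate j) else nothing

minimalDiagram : ℕ → ℕ → Raw
minimalDiagram n p = map (λ k → minEntry p (suc k)) (upTo n)

-- Linear algebra over a commutative ring R with parameter q.
-- inv k is meant to be the inverse of Δ_k(q) (hypothesis in the theorem).

module TL {c ℓ} (R : CommutativeRing c ℓ) (q : CommutativeRing.Carrier R)
          (inv : ℕ → CommutativeRing.Carrier R) where
  open CommutativeRing R

  Δ : ℕ → Carrier
  Δ zero          = 1#
  Δ (suc zero)    = q
  Δ (suc (suc k)) = q * Δ (suc k) - Δ k

  μ : ℕ → Carrier
  μ k = Δ (k ∸ 1) * inv k

  -- elements of U(n): formal linear combinations Σ c_b ξ_b
  LC : Set (c ⊔ Level.zero)
  LC = List (Carrier × Raw)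

  scale : Carrier → LC → LC
  scale s = map (λ { (x , d) → (s * x , d) })

  -- action of the generator e_i on a basis vector ξ_d
  -- (points i, i+1 of d are joined by the cap of e_i)
  eBasis : ℕ → Raw → LC
  eBasis i d with at d i | at d (suc i)
  ... | nothing | nothing = []
  ... | nothing | just y  =
        (1# , upd (upd (upd d i (just (suc i))) (suc i) (just i)) y nothing) ∷ []
  ... | just x  | nothing =
        (1# , upd (upd (upd d i (just (suc i))) (suc i) (just i)) x nothing) ∷ []
  ... | just x  | just y with x ℕ.≟ suc i
  ...   | yes _ = (q , d) ∷ []
  ...   | no  _ =
        (1# , upd (upd (upd (upd d i (just (suc i))) (suc i) (just i)) x (just y)) y (just x)) ∷ []

  eAct : ℕ → LC → LC
  eAct i = concatMap (λ { (x , d) → scale x (eBasis i d) })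

  eMinus : ℕ → Carrier → LC → LC
  eMinus i s v = eAct i v ++ scale (- s) v

  coeff : Raw → LC → Carrier
  coeff a = foldr (λ { (x , d) acc → (if does (d ≟R a) then x else 0#) + acc }) 0#
    where open import Relation.Nullary using (does)

  -- XiPrime n p a v : v is ξ'_a obtained from ξ_{(1,...,1)} (p pairs) along
  -- some sequence of box additions
  data XiPrime (n p : ℕ) : Raw → LC → Set (c ⊔ Level.zero) where
    base : XiPrime n p (minimalDiagram n p) ((1# , minimalDiagram n p) ∷ [])
    step : ∀ {a v b} (i : ℕ) → XiPrime n p a v → MinAt n a i → IsDiamond n i a b →
           XiPrime n p b (eMinus i (μ (suc ∣ height a i ∣)) v)

module Submission where

open import Defs
open import Data.Nat using (ℕ; _≤_; _*_)
open import Data.Product using (_×_)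
open import Relation.Binary.PropositionalEquality using (_≡_)
open import Algebra.Bundles using (CommutativeRing)

open import Data.Nat as N using (zero; suc; _<_; _∸_; z≤n; s≤s; _<ᵇ_; _+_)
import Data.Nat.Properties as NP
open import Data.Integer as Z using (ℤ; +_; -[1+_])
  renaming (_+_ to _⊕_; _≤_ to _≤ℤ_; _<_ to _<ℤ_)
import Data.Integer.Properties as ZP
open import Data.Integer.Tactic.RingSolver using (solve-∀)
open import Data.Maybe using (Maybe; just; nothing)
import Data.Maybe.Properties as MP
open import Data.Bool using (T; true; false; if_then_else_)
open import Data.Unit using (tt)
open import Data.List using ([]; _∷_; length; map; applyUpTo; upTo; _++_)
import Data.List.Properties as LP
open import Data.List.Relation.Unary.All as All using (All)
import Data.List.Relation.Unary.All.Properties as AllP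
open import Data.Product using (Σ; _,_; proj₁; proj₂)
open import Data.Sum using (_⊎_; inj₁; inj₂)
open import Data.Empty using (⊥; ⊥-elim)
open import Relation.Nullary using (¬_; yes; no; Dec; does)
open import Relation.Nullary.Decidable using (dec-true; dec-false)
open import Relation.Binary.PropositionalEquality using (refl; sym; trans; cong; cong₂; subst; _≢_)
open import Relation.Binary.Definitions using (tri<; tri≈; tri>)

-- Compare diagrams through their height functions: d lies strictly below a if
-- h_j(d) ≤ h_j(a) for all j ≤ n, with strict inequality somewhere.  Along the
-- box additions defining ξ'_a we carry the invariant: every term of ξ'_a is ξ_a
-- or ξ_d with d a pairing strictly below a, and the ξ_a-coefficients sum to 1.
-- Passing from a to b = ◇_i(a) uses two facts about e_i acting on ξ_d:
--   * e_i kills ξ_d, multiplies it by q (a loop closes), or rewires d; a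
--     rewiring raises no height except h_i, and h_i by at most 2, so terms
--     strictly below a are sent strictly below b;
--   * at a minimum i of a, e_i ξ_a = ξ_b: the rewiring of a is ◇_i(a).
-- The second fact reads partners off heights: in a half-diagram the partner of
-- a closing point j is the unique k with h_{k-1} = h_j and h > h_j on [k, j).
-- The terms of −μ ξ'_a lie at or below a, hence strictly below b.  No property
-- of μ is used.

at-upd-same : ∀ d j v → 1 ≤ j → j ≤ length d → at (upd d j v) j ≡ v
at-upd-same (x ∷ xs) (suc zero)    v _ _       = refl
at-upd-same (x ∷ xs) (suc (suc k)) v _ (s≤s q) = at-upd-same xs (suc k) v (s≤s z≤n) q

at-upd-other : ∀ d j m v → m ≢ j → at (upd d j v) m ≡ at d m
at-upd-other []       j             m             v ne = refl
at-upd-other (x ∷ xs) zero          m             v ne = refl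
at-upd-other (x ∷ xs) (suc zero)    zero          v ne = refl
at-upd-other (x ∷ xs) (suc zero)    (suc zero)    v ne = ⊥-elim (ne refl)
at-upd-other (x ∷ xs) (suc zero)    (suc (suc m)) v ne = refl
at-upd-other (x ∷ xs) (suc (suc k)) zero          v ne = refl
at-upd-other (x ∷ xs) (suc (suc k)) (suc zero)    v ne = refl
at-upd-other (x ∷ xs) (suc (suc k)) (suc (suc m)) v ne =
  at-upd-other xs (suc k) (suc m) v (λ e → ne (cong suc e))

length-upd : ∀ d j v → length (upd d j v) ≡ length d
length-upd []       j             v = refl
length-upd (x ∷ xs) zero          v = refl
length-upd (x ∷ xs) (suc zero)    v = refl
length-upd (x ∷ xs) (suc (suc k)) v = cong suc (length-upd xs (suc k) v)

at-zero : ∀ d → at d 0 ≡ nothing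
at-zero []      = refl
at-zero (_ ∷ _) = refl

at-just-range : ∀ d j k → at d j ≡ just k → (1 ≤ j) × (j ≤ length d)
at-just-range (x ∷ xs) (suc zero)    k e = s≤s z≤n , s≤s z≤n
at-just-range (x ∷ xs) (suc (suc j)) k e = s≤s z≤n , s≤s (proj₂ (at-just-range xs (suc j) k e))

at-ext : ∀ d e → length d ≡ length e → (∀ k → at d (suc k) ≡ at e (suc k)) → d ≡ e
at-ext []       []       _ _ = refl
at-ext (x ∷ xs) (y ∷ ys) l f =
  cong₂ _∷_ (f zero) (at-ext xs ys (NP.suc-injective l) (λ k → f (suc k)))

at-functional : ∀ {d : Raw} {i a b} → at d i ≡ just a → at d i ≡ just b → a ≡ b
at-functional e1 e2 = MP.just-injective (trans (sym e1) e2)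

nothing≢just : ∀ {k : ℕ} → nothing ≢ just k
nothing≢just ()

-- Step values and heights.  σ d j = h_j(d) − h_{j−1}(d) is +1 at a
-- through-string or an opening point and −1 at a closing point.

σ : Raw → ℕ → ℤ
σ d j = stepVal j (at d j)

-1ℤ : ℤ
-1ℤ = -[1+ 0 ]

+1≢-1 : + 1 ≢ -1ℤ
+1≢-1 ()

<ᵇ-true : ∀ j k → j < k → (j <ᵇ k) ≡ true
<ᵇ-true zero    (suc k) _       = refl
<ᵇ-true (suc j) (suc k) (s≤s p) = <ᵇ-true j k p

<ᵇ-false : ∀ j k → k ≤ j → (j <ᵇ k) ≡ false
<ᵇ-false j       zero    _       = refl
<ᵇ-false (suc j) (suc k) (s≤s p) = <ᵇ-false j k p

stepVal-opening : ∀ j k → j < k → stepVal j (just k) ≡ + 1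
stepVal-opening j k p rewrite <ᵇ-true j k p = refl

stepVal-closing : ∀ j k → k ≤ j → stepVal j (just k) ≡ -1ℤ
stepVal-closing j k p rewrite <ᵇ-false j k p = refl

stepVal-cases : ∀ j v → stepVal j v ≡ + 1 ⊎ stepVal j v ≡ -1ℤ
stepVal-cases j nothing = inj₁ refl
stepVal-cases j (just k) with j <ᵇ k
... | true  = inj₁ refl
... | false = inj₂ refl

σ-opening : ∀ d j k → at d j ≡ just k → j < k → σ d j ≡ + 1
σ-opening d j k e p = trans (cong (stepVal j) e) (stepVal-opening j k p)

σ-closing : ∀ d j k → at d j ≡ just k → k ≤ j → σ d j ≡ -1ℤ
σ-closing d j k e p = trans (cong (stepVal j) e) (stepVal-closing j k p)

σ-string : ∀ d j → at d j ≡ nothing → σ d j ≡ + 1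
σ-string d j e = cong (stepVal j) e

+1-1 : ∀ a → a ⊕ + 1 ⊕ -[1+ 0 ] ≡ a
+1-1 = solve-∀

-1+1 : ∀ a → (a ⊕ -[1+ 0 ]) ⊕ + 1 ≡ a
-1+1 = solve-∀

-1+2 : ∀ a → (a ⊕ -[1+ 0 ]) ⊕ + 2 ≡ a ⊕ + 1
-1+2 = solve-∀

-2+2 : ∀ a → a ≡ (a ⊕ -[1+ 1 ]) ⊕ + 2
-2+2 = solve-∀

swap-last : ∀ a s c → (a ⊕ s) ⊕ c ≡ (a ⊕ c) ⊕ s
swap-last = solve-∀

swap-inner : ∀ a s c → a ⊕ (s ⊕ c) ≡ (a ⊕ c) ⊕ s
swap-inner = solve-∀

reassoc : ∀ a s c → (a ⊕ s) ⊕ c ≡ a ⊕ (s ⊕ c)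
reassoc = solve-∀

cancel-left : ∀ a s → s ≡ (Z.- a) ⊕ (a ⊕ s)
cancel-left = solve-∀

⊕-cancelˡ : ∀ a s t → a ⊕ s ≡ a ⊕ t → s ≡ t
⊕-cancelˡ a s t h = trans (cancel-left a s) (trans (cong (Z.- a ⊕_) h) (sym (cancel-left a t)))

≤+1 : ∀ a → a ≤ℤ a ⊕ + 1
≤+1 a = ZP.i≤i+j a (+ 1)

-1< : ∀ a → a ⊕ -1ℤ <ℤ a
-1< a = subst (a ⊕ -1ℤ <ℤ_) (ZP.+-identityʳ a) (ZP.+-monoʳ-< a Z.-<+)

<+2 : ∀ a → a <ℤ a ⊕ + 2
<+2 a = subst (_<ℤ a ⊕ + 2) (ZP.+-identityʳ a) (ZP.+-monoʳ-< a (Z.+<+ (s≤s z≤n)))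

+1<+2 : ∀ a → a ⊕ + 1 <ℤ a ⊕ + 2
+1<+2 a = ZP.+-monoʳ-< a (Z.+<+ (s≤s (s≤s z≤n)))

σ-descent : ∀ d i → 1 ≤ i → height d i <ℤ height d (i ∸ 1) → σ d i ≡ -1ℤ
σ-descent d (suc i') _ h with stepVal-cases (suc i') (at d (suc i'))
... | inj₂ p = p
... | inj₁ p = ⊥-elim (ZP.<-irrefl refl (ZP.≤-<-trans (≤+1 (height d i'))
                 (subst (λ z → height d i' ⊕ z <ℤ height d i') p h)))

σ-ascent : ∀ d i → height d i <ℤ height d (suc i) → σ d (suc i) ≡ + 1
σ-ascent d i h with stepVal-cases (suc i) (at d (suc i))
... | inj₁ p = p
... | inj₂ p = ⊥-elim (ZP.<-asym (subst (λ z → height d i <ℤ height d i ⊕ z) p h) (-1< (height d i)))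

-- Pairings: the involutive part of a half-diagram, each pair {i,j} recorded at
-- both ends.  Rewirings preserve pairings.

record Pairing (n : ℕ) (d : Raw) : Set where
  field
    length≡ : length d ≡ n
    paired  : ∀ i j → at d i ≡ just j → (1 ≤ j) × (j ≤ n) × (j ≢ i) × (at d j ≡ just i)

halfDiagram⇒pairing : ∀ {n d} → HalfDiagram n d → Pairing n d
halfDiagram⇒pairing H = record { length≡ = HalfDiagram.len H ; paired = HalfDiagram.pairing H }

module PairingProps {n d} (P : Pairing n d) where
  partner-pos : ∀ {i j} → at d i ≡ just j → 1 ≤ j
  partner-pos {i} {j} e = proj₁ (Pairing.paired P i j e)

  partner-≤n : ∀ {i j} → at d i ≡ just j → j ≤ n
  partner-≤n {i} {j} e = proj₁ (proj₂ (Pairing.paired P i j e))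

  partner-≢ : ∀ {i j} → at d i ≡ just j → j ≢ i
  partner-≢ {i} {j} e = proj₁ (proj₂ (proj₂ (Pairing.paired P i j e)))

  partner-sym : ∀ {i j} → at d i ≡ just j → at d j ≡ just i
  partner-sym {i} {j} e = proj₂ (proj₂ (proj₂ (Pairing.paired P i j e)))

  partner-unique : ∀ {i a b} → at d i ≡ just a → at d i ≡ just b → a ≡ b
  partner-unique = at-functional {d}

  point-≤n : ∀ {i j} → at d i ≡ just j → i ≤ n
  point-≤n e = partner-≤n (partner-sym e)

  closing-partner : ∀ j → σ d j ≡ -1ℤ → Σ ℕ λ k → at d j ≡ just k × k < j
  closing-partner j e with at d j in eq
  ... | nothing = ⊥-elim (+1≢-1 e)
  ... | just k with NP.<-cmp k j
  ...   | tri< k<j _ _ = k , refl , k<j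
  ...   | tri≈ _ k≡j _ = ⊥-elim (partner-≢ eq k≡j)
  ...   | tri> _ _ j<k = ⊥-elim (+1≢-1 (trans (sym (stepVal-opening j k j<k)) e))

  closing-≤n : ∀ j → σ d j ≡ -1ℤ → j ≤ n
  closing-≤n j e = point-≤n (proj₁ (proj₂ (closing-partner j e)))

-- Arches.  Arch h k j says that, in the height function h, the closing point j
-- is joined to k: h_{k−1} = h_j and h stays strictly above h_j on [k, j).

Arch : (ℕ → ℤ) → ℕ → ℕ → Set
Arch h k j = (1 ≤ k) × (k < j) × (h (k ∸ 1) ≡ h j) × (∀ m → k ≤ m → m < j → h j <ℤ h m)

<⇒≤pred : ∀ {k k'} → k < k' → k ≤ k' ∸ 1
<⇒≤pred {k} {suc k'} (s≤s p) = p

pred< : ∀ {k j} → k < j → k ∸ 1 < j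
pred< {k} p = NP.≤-<-trans (NP.m∸n≤m k 1) p

pred<self : ∀ i → 1 ≤ i → i ∸ 1 < i
pred<self (suc i') _ = NP.n<1+n i'

arch-unique : ∀ {h k k' j} → Arch h k j → Arch h k' j → k ≡ k'
arch-unique {h} {k} {k'} (_ , kj , e , f) (_ , kj' , e' , f') with NP.<-cmp k k'
... | tri≈ _ p _    = p
... | tri< k<k' _ _ = ⊥-elim (ZP.<-irrefl (sym e') (f (k' ∸ 1) (<⇒≤pred k<k') (pred< kj')))
... | tri> _ _ k'<k = ⊥-elim (ZP.<-irrefl (sym e) (f' (k ∸ 1) (<⇒≤pred k'<k) (pred< kj)))

arch⇒closing : ∀ d k j → Arch (height d) k j → σ d j ≡ -1ℤ
arch⇒closing d k (suc j') (_ , kj , _ , f) with stepVal-cases (suc j') (at d (suc j'))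
... | inj₂ p = p
... | inj₁ p = ⊥-elim (ZP.<-irrefl refl (ZP.≤-<-trans (≤+1 (height d j'))
                 (subst (λ z → height d j' ⊕ z <ℤ height d j') p (f j' (NP.≤-pred kj) (NP.n<1+n j')))))

-- The proof goes
-- through "enclosed" intervals (u, w], all of whose points are paired inside
-- (u, w]: for them h_w = h_u and h ≥ h_u on [u, w].  Noncrossing is what makes
-- the intervals inside and after the first arch enclosed again.

module HalfDiagramArches {n : ℕ} {d : Raw} (H : HalfDiagram n d) where
  open HalfDiagram H
  open PairingProps (halfDiagram⇒pairing H)

  Enclosed : ℕ → ℕ → Set
  Enclosed u w = ∀ t → u < t → t ≤ w → Σ ℕ λ s → at d t ≡ just s × u < s × s ≤ w

  enclosed-inside : ∀ {u w s'} → Enclosed u w → at d (suc u) ≡ just (suc s') → suc u < suc s' →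
                    suc s' ≤ w → Enclosed (suc u) s'
  enclosed-inside {u} {w} {s'} B ats t<s sw t ut t≤s' with B t (NP.<-trans (NP.n<1+n u) ut) (NP.≤-trans (NP.m≤n⇒m≤1+n t≤s') sw)
  ... | r , atr , ur , rw = r , atr , above , below
    where
    atr' = partner-sym atr
    above : suc u < r
    above = NP.≤∧≢⇒< ur (λ e → NP.<-irrefl (sym (partner-unique ats (subst (λ z → at d z ≡ just t) (sym e) atr')))
                                            (NP.≤-<-trans t≤s' (NP.n<1+n s')))
    below : r ≤ s'
    below with NP.<-cmp r (suc s')
    ... | tri< a _ _ = NP.≤-pred a
    ... | tri≈ _ b _ = ⊥-elim (NP.<-irrefl (partner-unique (partner-sym ats) (subst (λ z → at d z ≡ just t) b atr')) ut)
    ... | tri> _ _ c = ⊥-elim (noncross (suc u) (suc s') t r ats atr ut (NP.≤-<-trans t≤s' (NP.n<1+n s')) c)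

  enclosed-after : ∀ {u w s} → Enclosed u w → at d (suc u) ≡ just s → suc u < s → Enclosed s w
  enclosed-after {u} {w} {s} B ats t<s t st tw with B t (NP.<-trans (NP.<-trans (NP.n<1+n u) t<s) st) tw
  ... | r , atr , ur , rw = r , atr , above , rw
    where
    atr' = partner-sym atr
    above : s < r
    above with NP.<-cmp r s
    ... | tri> _ _ c = c
    ... | tri≈ _ b _ = ⊥-elim (NP.<-irrefl (partner-unique (partner-sym ats) (subst (λ z → at d z ≡ just t) b atr'))
                                           (NP.<-trans t<s st))
    ... | tri< a _ _ with NP.m≤n⇒m<n∨m≡n ur
    ...   | inj₂ e   = ⊥-elim (NP.<-irrefl (partner-unique ats (subst (λ z → at d z ≡ just t) (sym e) atr')) st)
    ...   | inj₁ ur' = ⊥-elim (noncross (suc u) s r t ats atr' ur' a st)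

  -- Heights across an enclosed interval; N bounds its length (induction measure).
  enclosed-heights : ∀ N u w → w ≤ u + N → u ≤ w → Enclosed u w →
                     (height d w ≡ height d u) × (∀ m → u ≤ m → m ≤ w → height d u ≤ℤ height d m)
  enclosed-heights N u w wN uw B with NP.m≤n⇒m<n∨m≡n uw
  ... | inj₂ refl = refl , λ m um mw → ZP.≤-reflexive (cong (height d) (NP.≤-antisym um mw))
  enclosed-heights zero u w wN uw B | inj₁ u<w =
    ⊥-elim (NP.<-irrefl refl (NP.<-≤-trans u<w (subst (w ≤_) (NP.+-identityʳ u) wN)))
  enclosed-heights (suc N) u w wN uw B | inj₁ u<w with B (suc u) (NP.n<1+n u) u<w
  ... | zero , ats , () , _
  ... | suc s' , ats , us , sw = hw , lower
    where
    s = suc s'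
    t<s : suc u < s
    t<s = NP.≤∧≢⇒< us (λ e → partner-≢ ats (sym e))
    wN' : w ≤ suc (u + N)
    wN' = subst (w ≤_) (NP.+-suc u N) wN
    inner = enclosed-heights N (suc u) s' (NP.≤-trans (NP.≤-pred (NP.≤-trans sw wN')) (NP.n≤1+n _))
              (NP.≤-pred t<s) (enclosed-inside B ats t<s sw)
    outer = enclosed-heights N s w (NP.≤-trans wN' (NP.+-monoˡ-≤ N us)) sw (enclosed-after B ats t<s)
    h-open : height d (suc u) ≡ height d u ⊕ + 1
    h-open = cong (height d u ⊕_) (σ-opening d (suc u) s ats t<s)
    h-close : height d s ≡ height d s' ⊕ -1ℤ
    h-close = cong (height d s' ⊕_) (σ-closing d s (suc u) (partner-sym ats) (NP.<⇒≤ t<s))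
    hs : height d s ≡ height d u
    hs = trans h-close (trans (cong (_⊕ -1ℤ) (trans (proj₁ inner) h-open)) (+1-1 (height d u)))
    hw : height d w ≡ height d u
    hw = trans (proj₁ outer) hs
    lower : ∀ m → u ≤ m → m ≤ w → height d u ≤ℤ height d m
    lower m um mw with NP.m≤n⇒m<n∨m≡n um
    ... | inj₂ refl = ZP.≤-refl
    ... | inj₁ um' with NP.<-cmp m s
    ...   | tri< a _ _ = ZP.≤-trans (≤+1 _) (ZP.≤-trans (ZP.≤-reflexive (sym h-open)) (proj₂ inner m um' (NP.≤-pred a)))
    ...   | tri≈ _ b _ = ZP.≤-reflexive (sym (trans (cong (height d) b) hs))
    ...   | tri> _ _ c = ZP.≤-trans (ZP.≤-reflexive (sym hs)) (proj₂ outer m (NP.<⇒≤ c) mw)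

  inside-pair-enclosed : ∀ {j' k} → at d k ≡ just (suc j') → k < suc j' → Enclosed k j'
  inside-pair-enclosed {j'} {k} atk kj t kt tj' with at d t in eq
  ... | nothing = ⊥-elim (noncrossTS k (suc j') t atk kt (s≤s tj') eq)
  ... | just r = r , refl , above , below
    where
    atr' = partner-sym eq
    above : k < r
    above with NP.<-cmp r k
    ... | tri> _ _ c = c
    ... | tri≈ _ b _ = ⊥-elim (NP.<-irrefl (sym (partner-unique atk (subst (λ z → at d z ≡ just t) b atr'))) (s≤s tj'))
    ... | tri< a _ _ = ⊥-elim (noncross r t k (suc j') atr' atk a kt (s≤s tj'))
    below : r ≤ j'
    below with NP.<-cmp r (suc j')
    ... | tri< a _ _ = NP.≤-pred a
    ... | tri≈ _ b _ = ⊥-elim (NP.<-irrefl (partner-unique (partner-sym atk) (subst (λ z → at d z ≡ just t) b atr')) kt)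
    ... | tri> _ _ c = ⊥-elim (noncross k (suc j') t r atk eq kt (s≤s tj') c)

  pair-arch : ∀ j k → at d j ≡ just k → k < j → Arch (height d) k j
  pair-arch (suc j') zero    e kj = ⊥-elim (NP.<-irrefl refl (partner-pos e))
  pair-arch (suc j') (suc k') e kj =
    s≤s z≤n , kj , sym hjk , λ m km mj → ZP.<-≤-trans (subst (_<ℤ height d k) (sym hj) (-1< (height d k)))
                                                        (proj₂ inside m km (NP.≤-pred mj))
    where
    k = suc k'
    atk : at d k ≡ just (suc j')
    atk = partner-sym e
    inside = enclosed-heights j' k j' (NP.m≤n+m j' k) (NP.≤-pred kj) (inside-pair-enclosed atk kj)
    hj : height d (suc j') ≡ height d k ⊕ -1ℤ
    hj = trans (cong (height d j' ⊕_) (σ-closing d (suc j') k e (NP.<⇒≤ kj))) (cong (_⊕ -1ℤ) (proj₁ inside))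
    hjk : height d (suc j') ≡ height d k'
    hjk = trans hj (trans (cong (_⊕ -1ℤ) (cong (height d k' ⊕_) (σ-opening d k (suc j') atk kj))) (+1-1 _))

-- When e_i does not close a loop it sends ξ_d to ξ_e where e
-- pairs i with i+1 and joins the former partners of i and i+1 to each other
-- (a through-string at i or i+1 is handed over to the other former partner).
-- Rewiring i d e records this pointwise.

record Rewiring (i : ℕ) (d e : Raw) : Set where
  field
    length≡   : length e ≡ length d
    at-i      : at e i ≡ just (suc i)
    at-suc-i  : at e (suc i) ≡ just i
    mate-of-i     : ∀ m → m ≢ i → m ≢ suc i → at d m ≡ just i → at e m ≡ at d (suc i)
    mate-of-suc-i : ∀ m → m ≢ i → m ≢ suc i → at d m ≡ just (suc i) → at e m ≡ at d i
    elsewhere     : ∀ m → m ≢ i → m ≢ suc i → at d m ≢ just i → at d m ≢ just (suc i) → at e m ≡ at d m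

Maybe-≟ : ∀ (a b : Maybe ℕ) → Dec (a ≡ b)
Maybe-≟ = MP.≡-dec NP._≟_

suc≢ : ∀ i → suc i ≢ i
suc≢ i = NP.1+n≢n

≢suc : ∀ i → i ≢ suc i
≢suc i h = NP.1+n≢n (sym h)

PairedIn : ℕ → Raw → ℕ → ℕ → Set
PairedIn n e m k = (1 ≤ k) × (k ≤ n) × (k ≢ m) × (at e k ≡ just m)

module RewiringPairs {n i d e} (P : Pairing n d) (R : Rewiring i d e) where
  open PairingProps P
  open Rewiring R

  former-mate-of-i : ∀ {m k} → m ≢ i → m ≢ suc i → at d m ≡ just i → at e m ≡ just k → PairedIn n e m k
  former-mate-of-i {m} {k} mi msi dm em =
    partner-pos adk , partner-≤n adk , k≢m , trans (mate-of-suc-i k k≢i (partner-≢ adk) (partner-sym adk)) (partner-sym dm)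
    where
    adk : at d (suc i) ≡ just k
    adk = trans (sym (mate-of-i m mi msi dm)) em
    k≢i : k ≢ i
    k≢i refl = msi (partner-unique (partner-sym dm) (partner-sym adk))
    k≢m : k ≢ m
    k≢m refl = suc≢ i (partner-unique (partner-sym adk) dm)

  former-mate-of-suc-i : ∀ {m k} → m ≢ i → m ≢ suc i → at d m ≡ just (suc i) → at e m ≡ just k → PairedIn n e m k
  former-mate-of-suc-i {m} {k} mi msi dm em =
    partner-pos adk , partner-≤n adk , k≢m , trans (mate-of-i k (partner-≢ adk) k≢si (partner-sym adk)) (partner-sym dm)
    where
    adk : at d i ≡ just k
    adk = trans (sym (mate-of-suc-i m mi msi dm)) em
    k≢si : k ≢ suc i
    k≢si refl = mi (partner-unique (partner-sym dm) (partner-sym adk))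
    k≢m : k ≢ m
    k≢m refl = suc≢ i (partner-unique dm (partner-sym adk))

  untouched : ∀ {m k} → m ≢ i → m ≢ suc i → at d m ≢ just i → at d m ≢ just (suc i) → at e m ≡ just k → PairedIn n e m k
  untouched {m} {k} mi msi n1 n2 em =
    partner-pos dk , partner-≤n dk , partner-≢ dk , trans (elsewhere k k≢i k≢si c1 c2) (partner-sym dk)
    where
    dk : at d m ≡ just k
    dk = trans (sym (elsewhere m mi msi n1 n2)) em
    k≢i : k ≢ i
    k≢i refl = n1 dk
    k≢si : k ≢ suc i
    k≢si refl = n2 dk
    c1 : at d k ≢ just i
    c1 h = mi (partner-unique (partner-sym dk) h)
    c2 : at d k ≢ just (suc i)
    c2 h = msi (partner-unique (partner-sym dk) h)

rewiring-pairing : ∀ {n i d e} → Pairing n d → 1 ≤ i → suc i ≤ n → Rewiring i d e → Pairing n e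
rewiring-pairing {n} {i} {d} {e} P i1 in' R = record { length≡ = trans length≡ (Pairing.length≡ P) ; paired = paired }
  where
  open Rewiring R
  open RewiringPairs P R
  paired : ∀ m k → at e m ≡ just k → PairedIn n e m k
  paired m k em with m N.≟ i | m N.≟ suc i
  ... | yes refl | _ with at-functional {e} at-i em
  ...   | refl = s≤s z≤n , in' , suc≢ i , at-suc-i
  paired m k em | no mi | yes refl with at-functional {e} at-suc-i em
  ...   | refl = i1 , NP.≤-trans (NP.n≤1+n i) in' , ≢suc i , at-i
  paired m k em | no mi | no msi with Maybe-≟ (at d m) (just i) | Maybe-≟ (at d m) (just (suc i))
  ... | yes dm | _      = former-mate-of-i mi msi dm em
  ... | no _   | yes dm = former-mate-of-suc-i mi msi dm em
  ... | no n1  | no n2  = untouched mi msi n1 n2 em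

withCap : ℕ → Raw → Raw
withCap i d = upd (upd d i (just (suc i))) (suc i) (just i)

module RewiringShapes {n i d} (P : Pairing n d) (i1 : 1 ≤ i) (in' : suc i ≤ n) where
  open PairingProps P

  length-withCap : length (withCap i d) ≡ length d
  length-withCap = trans (length-upd (upd d i (just (suc i))) (suc i) (just i)) (length-upd d i (just (suc i)))

  withCap-i : at (withCap i d) i ≡ just (suc i)
  withCap-i = trans (at-upd-other (upd d i (just (suc i))) (suc i) i (just i) (≢suc i))
                    (at-upd-same d i (just (suc i)) i1 (subst (i ≤_) (sym (Pairing.length≡ P)) (NP.≤-trans (NP.n≤1+n i) in')))

  withCap-suc-i : at (withCap i d) (suc i) ≡ just i
  withCap-suc-i = at-upd-same (upd d i (just (suc i))) (suc i) (just i) (s≤s z≤n)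
                    (subst (suc i ≤_) (sym (trans (length-upd d i (just (suc i))) (Pairing.length≡ P))) in')

  withCap-other : ∀ m → m ≢ i → m ≢ suc i → at (withCap i d) m ≡ at d m
  withCap-other m a b = trans (at-upd-other (upd d i (just (suc i))) (suc i) m (just i) b) (at-upd-other d i m (just (suc i)) a)

  in-range : ∀ {x y} → at d x ≡ just y → x ≤ length (withCap i d)
  in-range {x} e = subst (x ≤_) (sym (trans length-withCap (Pairing.length≡ P))) (point-≤n e)

  rewire-string-pair : ∀ {y} → at d i ≡ nothing → at d (suc i) ≡ just y → Rewiring i d (upd (withCap i d) y nothing)
  rewire-string-pair {y} e1 e2 = record
    { length≡ = trans (length-upd (withCap i d) y nothing) length-withCap
    ; at-i = trans (at-upd-other (withCap i d) y i nothing (λ h → y≢i (sym h))) withCap-i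
    ; at-suc-i = trans (at-upd-other (withCap i d) y (suc i) nothing (λ h → partner-≢ e2 (sym h))) withCap-suc-i
    ; mate-of-i = λ m _ _ dm → ⊥-elim (nothing≢just (trans (sym e1) (partner-sym dm)))
    ; mate-of-suc-i = λ m mi msi dm → trans (cong (at (upd (withCap i d) y nothing)) (partner-unique (partner-sym dm) e2))
                   (trans (at-upd-same (withCap i d) y nothing (partner-pos e2) (in-range (partner-sym e2))) (sym e1))
    ; elsewhere = λ m mi msi n1 n2 → trans (at-upd-other (withCap i d) y m nothing
                   (λ h → n2 (subst (λ z → at d z ≡ just (suc i)) (sym h) (partner-sym e2)))) (withCap-other m mi msi)
    }
    where
    y≢i : y ≢ i
    y≢i refl = nothing≢just (trans (sym e1) (partner-sym e2))

  rewire-pair-string : ∀ {x} → at d i ≡ just x → at d (suc i) ≡ nothing → Rewiring i d (upd (withCap i d) x nothing)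
  rewire-pair-string {x} e1 e2 = record
    { length≡ = trans (length-upd (withCap i d) x nothing) length-withCap
    ; at-i = trans (at-upd-other (withCap i d) x i nothing (λ h → partner-≢ e1 (sym h))) withCap-i
    ; at-suc-i = trans (at-upd-other (withCap i d) x (suc i) nothing (λ h → x≢si (sym h))) withCap-suc-i
    ; mate-of-i = λ m mi msi dm → trans (cong (at (upd (withCap i d) x nothing)) (partner-unique (partner-sym dm) e1))
                   (trans (at-upd-same (withCap i d) x nothing (partner-pos e1) (in-range (partner-sym e1))) (sym e2))
    ; mate-of-suc-i = λ m _ _ dm → ⊥-elim (nothing≢just (trans (sym e2) (partner-sym dm)))
    ; elsewhere = λ m mi msi n1 n2 → trans (at-upd-other (withCap i d) x m nothing
                   (λ h → n1 (subst (λ z → at d z ≡ just i) (sym h) (partner-sym e1)))) (withCap-other m mi msi)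
    }
    where
    x≢si : x ≢ suc i
    x≢si refl = nothing≢just (trans (sym e2) (partner-sym e1))

  withCapJoin : ℕ → ℕ → Raw
  withCapJoin x y = upd (upd (withCap i d) x (just y)) y (just x)

  rewire-pair-pair : ∀ {x y} → at d i ≡ just x → at d (suc i) ≡ just y → x ≢ suc i → Rewiring i d (withCapJoin x y)
  rewire-pair-pair {x} {y} e1 e2 x≢si = record
    { length≡ = trans (length-upd (upd (withCap i d) x (just y)) y (just x)) (trans (length-upd (withCap i d) x (just y)) length-withCap)
    ; at-i = trans (at-upd-other (upd (withCap i d) x (just y)) y i (just x) (λ h → y≢i (sym h)))
                   (trans (at-upd-other (withCap i d) x i (just y) (λ h → partner-≢ e1 (sym h))) withCap-i)
    ; at-suc-i = trans (at-upd-other (upd (withCap i d) x (just y)) y (suc i) (just x) (λ h → partner-≢ e2 (sym h)))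
                       (trans (at-upd-other (withCap i d) x (suc i) (just y) (λ h → x≢si (sym h))) withCap-suc-i)
    ; mate-of-i = λ m mi msi dm → trans (cong (at (withCapJoin x y)) (partner-unique (partner-sym dm) e1))
                   (trans (at-upd-other (upd (withCap i d) x (just y)) y x (just x) x≢y)
                     (trans (at-upd-same (withCap i d) x (just y) (partner-pos e1) (in-range (partner-sym e1))) (sym e2)))
    ; mate-of-suc-i = λ m mi msi dm → trans (cong (at (withCapJoin x y)) (partner-unique (partner-sym dm) e2))
                   (trans (at-upd-same (upd (withCap i d) x (just y)) y (just x) (partner-pos e2)
                            (subst (y ≤_) (sym (length-upd (withCap i d) x (just y))) (in-range (partner-sym e2)))) (sym e1))
    ; elsewhere = λ m mi msi n1 n2 →
             trans (at-upd-other (upd (withCap i d) x (just y)) y m (just x) (λ h → n2 (subst (λ z → at d z ≡ just (suc i)) (sym h) (partner-sym e2))))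
               (trans (at-upd-other (withCap i d) x m (just y) (λ h → n1 (subst (λ z → at d z ≡ just i) (sym h) (partner-sym e1))))
                      (withCap-other m mi msi))
    }
    where
    y≢i : y ≢ i
    y≢i refl = x≢si (partner-unique e1 (partner-sym e2))
    x≢y : x ≢ y
    x≢y refl = suc≢ i (partner-unique (partner-sym e2) (partner-sym e1))

-- A rewiring changes step values at two
-- points p < q by amounts that compensate: σ_e(p) = σ_d(p) − c and
-- σ_e(q) = σ_d(q) + c.

HeightShift : Raw → Raw → ℕ → ℕ → ℤ → ℕ → Set
HeightShift d e p q c j = (j < p → height e j ≡ height d j)
                        × (p ≤ j → j < q → height e j ⊕ c ≡ height d j)
                        × (q ≤ j → height e j ≡ height d j)

compensated-steps : ∀ (d e : Raw) p q c → 1 ≤ p → p < q →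
                    σ e p ⊕ c ≡ σ d p → σ e q ≡ σ d q ⊕ c →
                    (∀ m → m ≢ p → m ≢ q → σ e m ≡ σ d m) →
                    ∀ j → HeightShift d e p q c j
compensated-steps d e p q c p1 pq hp hq ho zero =
  (λ _ → refl) , (λ pj _ → ⊥-elim (NP.<-irrefl refl (NP.≤-trans p1 pj))) ,
  (λ qj → ⊥-elim (NP.<-irrefl refl (NP.≤-trans (NP.≤-trans p1 (NP.<⇒≤ pq)) qj)))
compensated-steps d e p q c p1 pq hp hq ho (suc j) = before , inside , after
  where
  IH = compensated-steps d e p q c p1 pq hp hq ho j
  before : suc j < p → height e (suc j) ≡ height d (suc j)
  before sjp = cong₂ _⊕_ (proj₁ IH (NP.<-trans (NP.n<1+n j) sjp))
                         (ho (suc j) (NP.<⇒≢ sjp) (NP.<⇒≢ (NP.<-trans sjp pq)))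
  inside : p ≤ suc j → suc j < q → height e (suc j) ⊕ c ≡ height d (suc j)
  inside psj sjq with NP.m≤n⇒m<n∨m≡n psj
  ... | inj₂ refl = trans (reassoc (height e j) (σ e (suc j)) c) (cong₂ _⊕_ (proj₁ IH (NP.n<1+n j)) hp)
  ... | inj₁ p<sj = trans (swap-last (height e j) (σ e (suc j)) c)
                      (cong₂ _⊕_ (proj₁ (proj₂ IH) (NP.≤-pred p<sj) (NP.<-trans (NP.n<1+n j) sjq))
                                 (ho (suc j) (λ h → NP.<-irrefl (sym h) p<sj) (NP.<⇒≢ sjq)))
  after : q ≤ suc j → height e (suc j) ≡ height d (suc j)
  after qsj with NP.m≤n⇒m<n∨m≡n qsj
  ... | inj₂ refl = trans (cong (height e j ⊕_) hq)
                      (trans (swap-inner (height e j) (σ d (suc j)) c)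
                             (cong (_⊕ σ d (suc j)) (proj₁ (proj₂ IH) (NP.≤-pred pq) (NP.n<1+n j))))
  ... | inj₁ q<sj = cong₂ _⊕_ (proj₂ (proj₂ IH) (NP.≤-pred q<sj))
                      (ho (suc j) (λ h → NP.<-irrefl (sym h) (NP.<-trans pq q<sj)) (λ h → NP.<-irrefl (sym h) q<sj))

BoundedRise : ℕ → Raw → Raw → Set
BoundedRise i d e = (∀ j → j ≢ i → height e j ≤ℤ height d j) × (height e i ≤ℤ height d i ⊕ + 2)

lowered⇒boundedRise : ∀ {i d e p q c} → (∀ a b → a ⊕ c ≡ b → a ≤ℤ b) →
                      (∀ j → HeightShift d e p q c j) → BoundedRise i d e
lowered⇒boundedRise {i} {d} {e} {p} {q} c≥0 G = (λ j _ → lower j) , ZP.≤-trans (lower i) (ZP.i≤i+j (height d i) (+ 2))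
  where
  lower : ∀ j → height e j ≤ℤ height d j
  lower j with j N.<? p | j N.<? q
  ... | yes jp | _      = ZP.≤-reflexive (proj₁ (G j) jp)
  ... | no jp  | yes jq = c≥0 _ _ (proj₁ (proj₂ (G j)) (NP.≮⇒≥ jp) jq)
  ... | no jp  | no jq  = ZP.≤-reflexive (proj₂ (proj₂ (G j)) (NP.≮⇒≥ jq))

shift+2 : ∀ a b → a ⊕ + 2 ≡ b → a ≤ℤ b
shift+2 a b h = subst (a ≤ℤ_) h (ZP.i≤i+j a (+ 2))

shift+0 : ∀ a b → a ⊕ + 0 ≡ b → a ≤ℤ b
shift+0 a b h = subst (a ≤ℤ_) h (ZP.≤-reflexive (sym (ZP.+-identityʳ a)))

raisedAt⇒boundedRise : ∀ {i d e} → (∀ j → HeightShift d e i (suc i) -[1+ 1 ] j) → BoundedRise i d e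
raisedAt⇒boundedRise {i} {d} {e} G =
  other , ZP.≤-reflexive (trans (-2+2 (height e i)) (cong (_⊕ + 2) (proj₁ (proj₂ (G i)) NP.≤-refl (NP.n<1+n i))))
  where
  other : ∀ j → j ≢ i → height e j ≤ℤ height d j
  other j ji with NP.<-cmp j i
  ... | tri< a _ _ = ZP.≤-reflexive (proj₁ (G j) a)
  ... | tri≈ _ b _ = ⊥-elim (ji b)
  ... | tri> _ _ c = ZP.≤-reflexive (proj₂ (proj₂ (G j)) c)

-- Every rewiring of a pairing satisfies BoundedRise, unless i and i+1 both
-- carry through-strings (then e_i kills ξ_d).  Each case names the two points
-- p < q where the step value changes, the compensating amount c ∈ {0, 2, −2},
-- and checks that σ is unchanged elsewhere (hp, hq, ho).  Only c = −2 raises a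
-- height, and then exactly h_i.
module RewiringHeights {n i d e} (P : Pairing n d) (i1 : 1 ≤ i) (R : Rewiring i d e) where
  open PairingProps P
  open Rewiring R

  σe-i : σ e i ≡ + 1
  σe-i = σ-opening e i (suc i) at-i (NP.n<1+n i)
  σe-suc-i : σ e (suc i) ≡ -1ℤ
  σe-suc-i = σ-closing e (suc i) i at-suc-i (NP.n≤1+n i)

  σ-away-from-cap : ∀ m → m ≢ i → m ≢ suc i →
         (at d m ≡ just i → stepVal m (at d (suc i)) ≡ σ d m) →
         (at d m ≡ just (suc i) → stepVal m (at d i) ≡ σ d m) → σ e m ≡ σ d m
  σ-away-from-cap m mi msi fA fB with Maybe-≟ (at d m) (just i) | Maybe-≟ (at d m) (just (suc i))
  ... | yes dm | _ = trans (cong (stepVal m) (mate-of-i m mi msi dm)) (fA dm)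
  ... | no _ | yes dm = trans (cong (stepVal m) (mate-of-suc-i m mi msi dm)) (fB dm)
  ... | no n1 | no n2 = cong (stepVal m) (elsewhere m mi msi n1 n2)

  string-then-pair-right : ∀ {y} → at d i ≡ nothing → at d (suc i) ≡ just y → suc i < y → BoundedRise i d e
  string-then-pair-right {y} e1 e2 ysi = lowered⇒boundedRise shift+2 (compensated-steps d e (suc i) y (+ 2) (s≤s z≤n) ysi hp hq ho)
    where
    yNi : y ≢ i
    yNi h = NP.<-irrefl (sym h) (NP.<-trans (NP.n<1+n i) ysi)
    hp : σ e (suc i) ⊕ + 2 ≡ σ d (suc i)
    hp = trans (cong (_⊕ + 2) σe-suc-i) (sym (σ-opening d (suc i) y e2 ysi))
    hq : σ e y ≡ σ d y ⊕ + 2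
    hq = trans (cong (stepVal y) (trans (mate-of-suc-i y yNi (partner-≢ e2) (partner-sym e2)) e1))
               (sym (cong (_⊕ + 2) (σ-closing d y (suc i) (partner-sym e2) (NP.<⇒≤ ysi))))
    ho : ∀ m → m ≢ suc i → m ≢ y → σ e m ≡ σ d m
    ho m mp mq with m N.≟ i | m N.≟ suc i
    ... | yes refl | _ = trans σe-i (sym (σ-string d i e1))
    ... | no _ | yes refl = ⊥-elim (mp refl)
    ... | no mi | no msi = σ-away-from-cap m mi msi (λ dm → ⊥-elim (nothing≢just (trans (sym e1) (partner-sym dm))))
                                         (λ dm → ⊥-elim (mq (partner-unique (partner-sym dm) e2)))

  string-then-pair-left : ∀ {y} → at d i ≡ nothing → at d (suc i) ≡ just y → y < i → BoundedRise i d e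
  string-then-pair-left {y} e1 e2 yi = lowered⇒boundedRise shift+0 (compensated-steps d e i (suc i) (+ 0) i1 (NP.n<1+n i) hp hq ho)
    where
    hp : σ e i ⊕ + 0 ≡ σ d i
    hp = trans (cong (_⊕ + 0) σe-i) (sym (σ-string d i e1))
    hq : σ e (suc i) ≡ σ d (suc i) ⊕ + 0
    hq = trans σe-suc-i (sym (cong (_⊕ + 0) (σ-closing d (suc i) y e2 (NP.≤-trans (NP.<⇒≤ yi) (NP.n≤1+n i)))))
    ho : ∀ m → m ≢ i → m ≢ suc i → σ e m ≡ σ d m
    ho m mi msi = σ-away-from-cap m mi msi (λ dm → ⊥-elim (nothing≢just (trans (sym e1) (partner-sym dm))))
                   (λ dm → trans (cong (stepVal m) e1)
                     (sym (σ-opening d m (suc i) dm (subst (_< suc i) (sym (partner-unique (partner-sym dm) e2)) (NP.<-trans yi (NP.n<1+n i))))))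

  pair-left-then-string : ∀ {x} → at d i ≡ just x → at d (suc i) ≡ nothing → x < i → BoundedRise i d e
  pair-left-then-string {x} e1 e2 xi = raisedAt⇒boundedRise (compensated-steps d e i (suc i) -[1+ 1 ] i1 (NP.n<1+n i) hp hq ho)
    where
    hp : σ e i ⊕ -[1+ 1 ] ≡ σ d i
    hp = trans (cong (_⊕ -[1+ 1 ]) σe-i) (sym (σ-closing d i x e1 (NP.<⇒≤ xi)))
    hq : σ e (suc i) ≡ σ d (suc i) ⊕ -[1+ 1 ]
    hq = trans σe-suc-i (sym (cong (_⊕ -[1+ 1 ]) (σ-string d (suc i) e2)))
    ho : ∀ m → m ≢ i → m ≢ suc i → σ e m ≡ σ d m
    ho m mi msi = σ-away-from-cap m mi msi
                   (λ dm → trans (cong (stepVal m) e2)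
                     (sym (σ-opening d m i dm (subst (_< i) (sym (partner-unique (partner-sym dm) e1)) xi))))
                   (λ dm → ⊥-elim (nothing≢just (trans (sym e2) (partner-sym dm))))

  pair-right-then-string : ∀ {x} → at d i ≡ just x → at d (suc i) ≡ nothing → suc i < x → BoundedRise i d e
  pair-right-then-string {x} e1 e2 xsi = lowered⇒boundedRise shift+2 (compensated-steps d e (suc i) x (+ 2) (s≤s z≤n) xsi hp hq ho)
    where
    xNi : x ≢ i
    xNi h = NP.<-irrefl (sym h) (NP.<-trans (NP.n<1+n i) xsi)
    hp : σ e (suc i) ⊕ + 2 ≡ σ d (suc i)
    hp = trans (cong (_⊕ + 2) σe-suc-i) (sym (σ-string d (suc i) e2))
    hq : σ e x ≡ σ d x ⊕ + 2
    hq = trans (cong (stepVal x) (trans (mate-of-i x xNi (λ h → NP.<-irrefl (sym h) xsi) (partner-sym e1)) e2))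
               (sym (cong (_⊕ + 2) (σ-closing d x i (partner-sym e1) (NP.<⇒≤ (NP.<-trans (NP.n<1+n i) xsi)))))
    ho : ∀ m → m ≢ suc i → m ≢ x → σ e m ≡ σ d m
    ho m mp mq with m N.≟ i | m N.≟ suc i
    ... | yes refl | _ = trans σe-i (sym (σ-opening d i x e1 (NP.<-trans (NP.n<1+n i) xsi)))
    ... | no _ | yes refl = ⊥-elim (mp refl)
    ... | no mi | no msi = σ-away-from-cap m mi msi (λ dm → ⊥-elim (mq (partner-unique (partner-sym dm) e1)))
                                         (λ dm → ⊥-elim (nothing≢just (trans (sym e2) (partner-sym dm))))

  cap-present : at d i ≡ just (suc i) → BoundedRise i d e
  cap-present e1 = lowered⇒boundedRise shift+0 (compensated-steps d e i (suc i) (+ 0) i1 (NP.n<1+n i) hp hq ho)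
    where
    hp : σ e i ⊕ + 0 ≡ σ d i
    hp = trans (cong (_⊕ + 0) σe-i) (sym (σ-opening d i (suc i) e1 (NP.n<1+n i)))
    hq : σ e (suc i) ≡ σ d (suc i) ⊕ + 0
    hq = trans σe-suc-i (sym (cong (_⊕ + 0) (σ-closing d (suc i) i (partner-sym e1) (NP.n≤1+n i))))
    ho : ∀ m → m ≢ i → m ≢ suc i → σ e m ≡ σ d m
    ho m mi msi = σ-away-from-cap m mi msi (λ dm → ⊥-elim (msi (partner-unique (partner-sym dm) e1)))
                                (λ dm → ⊥-elim (mi (partner-unique (partner-sym dm) (partner-sym e1))))

  outside-cap : ∀ z → z ≢ i → z ≢ suc i → z < i ⊎ suc i < z
  outside-cap z zi zsi with NP.<-cmp z i
  ... | tri< a _ _ = inj₁ a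
  ... | tri≈ _ b _ = ⊥-elim (zi b)
  ... | tri> _ _ c = inj₂ (NP.≤∧≢⇒< c (λ h → zsi (sym h)))

  module PairPair {x y} (e1 : at d i ≡ just x) (e2 : at d (suc i) ≡ just y) (xNsi : x ≢ suc i) where
    xNi : x ≢ i
    xNi = partner-≢ e1
    yNsi : y ≢ suc i
    yNsi = partner-≢ e2
    yNi : y ≢ i
    yNi refl = xNsi (partner-unique e1 (partner-sym e2))
    xNy : x ≢ y
    xNy refl = suc≢ i (partner-unique (partner-sym e2) (partner-sym e1))
    σeAx : σ e x ≡ stepVal x (just y)
    σeAx = cong (stepVal x) (trans (mate-of-i x xNi xNsi (partner-sym e1)) e2)
    σeBy : σ e y ≡ stepVal y (just x)
    σeBy = cong (stepVal y) (trans (mate-of-suc-i y yNi yNsi (partner-sym e2)) e1)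
    fA : stepVal x (just y) ≡ σ d x → ∀ {m} → at d m ≡ just i → stepVal m (at d (suc i)) ≡ σ d m
    fA g {m} dm with partner-unique (partner-sym dm) e1
    ... | refl = trans (cong (stepVal m) e2) g
    fB : stepVal y (just x) ≡ σ d y → ∀ {m} → at d m ≡ just (suc i) → stepVal m (at d i) ≡ σ d m
    fB g {m} dm with partner-unique (partner-sym dm) e2
    ... | refl = trans (cong (stepVal m) e1) g
    nA : ∀ {m} → m ≢ x → at d m ≡ just i → stepVal m (at d (suc i)) ≡ σ d m
    nA mx dm = ⊥-elim (mx (partner-unique (partner-sym dm) e1))
    nB : ∀ {m} → m ≢ y → at d m ≡ just (suc i) → stepVal m (at d i) ≡ σ d m
    nB my dm = ⊥-elim (my (partner-unique (partner-sym dm) e2))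
    dx< : x < i → σ d x ≡ + 1
    dx< xi = σ-opening d x i (partner-sym e1) xi
    dx> : i < x → σ d x ≡ -1ℤ
    dx> ix = σ-closing d x i (partner-sym e1) (NP.<⇒≤ ix)
    dy< : y < suc i → σ d y ≡ + 1
    dy< yi = σ-opening d y (suc i) (partner-sym e2) yi
    dy> : suc i < y → σ d y ≡ -1ℤ
    dy> iy = σ-closing d y (suc i) (partner-sym e2) (NP.<⇒≤ iy)
    di< : x < i → σ d i ≡ -1ℤ
    di< xi = σ-closing d i x e1 (NP.<⇒≤ xi)
    di> : i < x → σ d i ≡ + 1
    di> ix = σ-opening d i x e1 ix
    dsi< : y < suc i → σ d (suc i) ≡ -1ℤ
    dsi< yi = σ-closing d (suc i) y e2 (NP.<⇒≤ yi)
    dsi> : suc i < y → σ d (suc i) ≡ + 1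
    dsi> iy = σ-opening d (suc i) y e2 iy
    lt1 : ∀ {a} → a < i → a < suc i
    lt1 a = NP.<-trans a (NP.n<1+n i)
    lt2 : ∀ {a} → suc i < a → i < a
    lt2 a = NP.<-trans (NP.n<1+n i) a

    both-left-nested : x < i → y < x → BoundedRise i d e
    both-left-nested xi yx = lowered⇒boundedRise shift+2 (compensated-steps d e x i (+ 2) (partner-pos e1) xi hp hq ho)
      where
      hp : σ e x ⊕ + 2 ≡ σ d x
      hp = trans (cong (_⊕ + 2) (trans σeAx (stepVal-closing x y (NP.<⇒≤ yx)))) (sym (dx< xi))
      hq : σ e i ≡ σ d i ⊕ + 2
      hq = trans σe-i (sym (cong (_⊕ + 2) (di< xi)))
      ho : ∀ m → m ≢ x → m ≢ i → σ e m ≡ σ d m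
      ho m mx mi with m N.≟ suc i
      ... | yes refl = trans σe-suc-i (sym (dsi< (lt1 (NP.<-trans yx xi))))
      ... | no msi = σ-away-from-cap m mi msi (nA mx) (fB (trans (stepVal-opening y x yx) (sym (dy< (lt1 (NP.<-trans yx xi))))))

    both-left-side-by-side : x < i → x < y → y < i → BoundedRise i d e
    both-left-side-by-side xi xy yi = lowered⇒boundedRise shift+2 (compensated-steps d e y i (+ 2) (partner-pos e2) yi hp hq ho)
      where
      hp : σ e y ⊕ + 2 ≡ σ d y
      hp = trans (cong (_⊕ + 2) (trans σeBy (stepVal-closing y x (NP.<⇒≤ xy)))) (sym (dy< (lt1 yi)))
      hq : σ e i ≡ σ d i ⊕ + 2
      hq = trans σe-i (sym (cong (_⊕ + 2) (di< xi)))
      ho : ∀ m → m ≢ y → m ≢ i → σ e m ≡ σ d m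
      ho m my mi with m N.≟ suc i
      ... | yes refl = trans σe-suc-i (sym (dsi< (lt1 yi)))
      ... | no msi = σ-away-from-cap m mi msi (fA (trans (stepVal-opening x y xy) (sym (dx< xi)))) (nB my)

    left-and-right : x < i → suc i < y → BoundedRise i d e
    left-and-right xi iy = raisedAt⇒boundedRise (compensated-steps d e i (suc i) -[1+ 1 ] i1 (NP.n<1+n i) hp hq ho)
      where
      hp : σ e i ⊕ -[1+ 1 ] ≡ σ d i
      hp = trans (cong (_⊕ -[1+ 1 ]) σe-i) (sym (di< xi))
      hq : σ e (suc i) ≡ σ d (suc i) ⊕ -[1+ 1 ]
      hq = trans σe-suc-i (sym (cong (_⊕ -[1+ 1 ]) (dsi> iy)))
      xy : x < y
      xy = NP.<-trans xi (lt2 iy)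
      ho : ∀ m → m ≢ i → m ≢ suc i → σ e m ≡ σ d m
      ho m mi msi = σ-away-from-cap m mi msi (fA (trans (stepVal-opening x y xy) (sym (dx< xi))))
                                  (fB (trans (stepVal-closing y x (NP.<⇒≤ xy)) (sym (dy> iy))))

    right-and-left : suc i < x → y < i → BoundedRise i d e
    right-and-left ix yi = lowered⇒boundedRise shift+0 (compensated-steps d e i (suc i) (+ 0) i1 (NP.n<1+n i) hp hq ho)
      where
      hp : σ e i ⊕ + 0 ≡ σ d i
      hp = trans (cong (_⊕ + 0) σe-i) (sym (di> (lt2 ix)))
      hq : σ e (suc i) ≡ σ d (suc i) ⊕ + 0
      hq = trans σe-suc-i (sym (cong (_⊕ + 0) (dsi< (lt1 yi))))
      yx : y < x
      yx = NP.<-trans yi (lt2 ix)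
      ho : ∀ m → m ≢ i → m ≢ suc i → σ e m ≡ σ d m
      ho m mi msi = σ-away-from-cap m mi msi (fA (trans (stepVal-closing x y (NP.<⇒≤ yx)) (sym (dx> (lt2 ix)))))
                                  (fB (trans (stepVal-opening y x yx) (sym (dy< (lt1 yi)))))

    both-right-side-by-side : suc i < x → x < y → BoundedRise i d e
    both-right-side-by-side ix xy = lowered⇒boundedRise shift+2 (compensated-steps d e (suc i) x (+ 2) (s≤s z≤n) ix hp hq ho)
      where
      iy : suc i < y
      iy = NP.<-trans ix xy
      hp : σ e (suc i) ⊕ + 2 ≡ σ d (suc i)
      hp = trans (cong (_⊕ + 2) σe-suc-i) (sym (dsi> iy))
      hq : σ e x ≡ σ d x ⊕ + 2
      hq = trans (trans σeAx (stepVal-opening x y xy)) (sym (cong (_⊕ + 2) (dx> (lt2 ix))))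
      ho : ∀ m → m ≢ suc i → m ≢ x → σ e m ≡ σ d m
      ho m msi mx with m N.≟ i
      ... | yes refl = trans σe-i (sym (di> (lt2 ix)))
      ... | no mi = σ-away-from-cap m mi msi (nA mx) (fB (trans (stepVal-closing y x (NP.<⇒≤ xy)) (sym (dy> iy))))

    both-right-nested : suc i < y → y < x → BoundedRise i d e
    both-right-nested iy yx = lowered⇒boundedRise shift+2 (compensated-steps d e (suc i) y (+ 2) (s≤s z≤n) iy hp hq ho)
      where
      ix : suc i < x
      ix = NP.<-trans iy yx
      hp : σ e (suc i) ⊕ + 2 ≡ σ d (suc i)
      hp = trans (cong (_⊕ + 2) σe-suc-i) (sym (dsi> iy))
      hq : σ e y ≡ σ d y ⊕ + 2
      hq = trans (trans σeBy (stepVal-opening y x yx)) (sym (cong (_⊕ + 2) (dy> iy)))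
      ho : ∀ m → m ≢ suc i → m ≢ y → σ e m ≡ σ d m
      ho m msi my with m N.≟ i
      ... | yes refl = trans σe-i (sym (di> (lt2 ix)))
      ... | no mi = σ-away-from-cap m mi msi (fA (trans (stepVal-closing x y (NP.<⇒≤ yx)) (sym (dx> (lt2 ix))))) (nB my)

    boundedRise : BoundedRise i d e
    boundedRise with outside-cap x xNi xNsi | outside-cap y yNi yNsi
    ... | inj₁ xi | inj₂ iy = left-and-right xi iy
    ... | inj₂ ix | inj₁ yi = right-and-left ix yi
    ... | inj₁ xi | inj₁ yi with NP.<-cmp x y
    ...   | tri< a _ _ = both-left-side-by-side xi a yi
    ...   | tri≈ _ b _ = ⊥-elim (xNy b)
    ...   | tri> _ _ c = both-left-nested xi c
    boundedRise | inj₂ ix | inj₂ iy with NP.<-cmp x y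
    ...   | tri< a _ _ = both-right-side-by-side ix a
    ...   | tri≈ _ b _ = ⊥-elim (xNy b)
    ...   | tri> _ _ c = both-right-nested iy c

  rewiring-boundedRise : ¬ (at d i ≡ nothing × at d (suc i) ≡ nothing) → BoundedRise i d e
  rewiring-boundedRise nn with at d i in e1 | at d (suc i) in e2
  ... | nothing | nothing = ⊥-elim (nn (refl , refl))
  ... | nothing | just y with outside-cap y (λ h → nothing≢just (trans (sym e1) (subst (λ z → at d z ≡ just (suc i)) h (partner-sym e2)))) (partner-≢ e2)
  ...   | inj₁ yi = string-then-pair-left e1 e2 yi
  ...   | inj₂ iy = string-then-pair-right e1 e2 iy
  rewiring-boundedRise nn | just x | nothing with outside-cap x (partner-≢ e1) (λ h → nothing≢just (trans (sym e2) (subst (λ z → at d z ≡ just i) h (partner-sym e1))))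
  ...   | inj₁ xi = pair-left-then-string e1 e2 xi
  ...   | inj₂ ix = pair-right-then-string e1 e2 ix
  rewiring-boundedRise nn | just x | just y with x N.≟ suc i
  ...   | yes refl = cap-present e1
  ...   | no xNsi = PairPair.boundedRise e1 e2 xNsi


-- If all closing pairs of b and of e are
-- arches of the heights of b, and every closing point of b closes in e, then
-- b = e: a closing point j of b closes in both, and arch-unique forces the
-- same partner; the remaining points are handled by symmetry of pairings.

pairing-from-arches : ∀ {n b e} → Pairing n b → Pairing n e →
                      (∀ j k → at b j ≡ just k → k < j → Arch (height b) k j) →
                      (∀ j k → at e j ≡ just k → k < j → Arch (height b) k j) →
                      (∀ j → σ b j ≡ -1ℤ → σ e j ≡ -1ℤ) → b ≡ e
pairing-from-arches {n} {b} {e} PB PE archB archE closes =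
  at-ext b e (trans (Pairing.length≡ PB) (sym (Pairing.length≡ PE))) (λ k → pointwise (suc k))
  where
  module B = PairingProps PB
  module E = PairingProps PE

  closing-shared : ∀ j k → at b j ≡ just k → k < j → at e j ≡ just k
  closing-shared j k bj kj with E.closing-partner j (closes j (σ-closing b j k bj (NP.<⇒≤ kj)))
  ... | k' , ej , k'j = trans ej (cong just (arch-unique (archE j k' ej k'j) (archB j k bj kj)))

  pointwise : ∀ j → at b j ≡ at e j
  pointwise j with at b j in bj
  ... | just k with NP.<-cmp k j
  ...   | tri< p _ _ = sym (closing-shared j k bj p)
  ...   | tri≈ _ p _ = ⊥-elim (B.partner-≢ bj p)
  ...   | tri> _ _ p = sym (E.partner-sym (closing-shared k j (B.partner-sym bj) p))
  pointwise j | nothing with at e j in ej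
  ...   | nothing = refl
  ...   | just k with NP.<-cmp k j
  ...     | tri< p _ _ = ⊥-elim (+1≢-1 (trans (sym (σ-string b j bj)) (arch⇒closing b k j (archE j k ej p))))
  ...     | tri≈ _ p _ = ⊥-elim (E.partner-≢ ej p)
  ...     | tri> _ _ p with B.closing-partner k (arch⇒closing b j k (archE k j (E.partner-sym ej) p))
  ...       | j' , bk , j'k with E.partner-unique (E.partner-sym ej) (closing-shared k j' bk j'k)
  ...         | refl = ⊥-elim (nothing≢just (trans (sym bj) (B.partner-sym bk)))

valley-ends : ∀ a i → 1 ≤ i → σ a i ≡ -1ℤ → σ a (suc i) ≡ + 1 → height a (i ∸ 1) ≡ height a (suc i)
valley-ends a (suc i') _ σi σsi = sym (trans (cong (height a (suc i') ⊕_) σsi)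
                                    (trans (cong (λ z → (height a i' ⊕ z) ⊕ + 1) σi) (-1+1 (height a i'))))

raised-step : ∀ a b i → 1 ≤ i → height b (i ∸ 1) ≡ height a (i ∸ 1) → height b i ≡ height a i ⊕ + 2 →
              σ a i ≡ -1ℤ → σ b i ≡ + 1
raised-step a b (suc i') _ h0 hi σi =
  ⊕-cancelˡ (height a i') _ _ (trans (cong (_⊕ σ b (suc i')) (sym h0))
     (trans hi (trans (cong (λ z → (height a i' ⊕ z) ⊕ + 2) σi) (-1+2 (height a i')))))

StrictlyBelow : ℕ → Raw → Raw → Set
StrictlyBelow n d a = (∀ j → j ≤ n → height d j ≤ℤ height a j) × Σ ℕ (λ j → (j ≤ n) × (height d j <ℤ height a j))

strictlyBelow⇒≢ : ∀ {n d a} → StrictlyBelow n d a → d ≢ a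
strictlyBelow⇒≢ (_ , j , _ , lt) refl = ZP.<-irrefl refl lt

module BoxAddition {n i a b} (mn : MinAt n a i) (dmd : IsDiamond n i a b) where
  i1 : 1 ≤ i
  i1 = proj₁ mn

  in' : suc i ≤ n
  in' = proj₁ (proj₂ mn)

  i≤n : i ≤ n
  i≤n = NP.<⇒≤ in'

  hb-eq : ∀ j → j ≤ n → j ≢ i → height b j ≡ height a j
  hb-eq = proj₂ (proj₂ dmd)

  hb-i : height b i ≡ height a i ⊕ + 2
  hb-i = proj₁ (proj₂ dmd)

  hb-pred-i : height b (i ∸ 1) ≡ height a (i ∸ 1)
  hb-pred-i = hb-eq (i ∸ 1) (NP.≤-trans (NP.m∸n≤m i 1) i≤n) (λ h → NP.<-irrefl h (pred<self i i1))

  a≤b : ∀ m → m ≤ n → height a m ≤ℤ height b m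
  a≤b m m≤n with m N.≟ i
  ... | yes refl = ZP.≤-trans (ZP.i≤i+j (height a i) (+ 2)) (ZP.≤-reflexive (sym hb-i))
  ... | no mi    = ZP.≤-reflexive (sym (hb-eq m m≤n mi))

  a-below-b : StrictlyBelow n a b
  a-below-b = a≤b , i , i≤n , subst (height a i <ℤ_) (sym hb-i) (<+2 (height a i))

  below-a⇒below-b : ∀ {d} → StrictlyBelow n d a → StrictlyBelow n d b
  below-a⇒below-b (le , j , jn , lt) = (λ m m≤n → ZP.≤-trans (le m m≤n) (a≤b m m≤n)) , j , jn , ZP.<-≤-trans lt (a≤b j jn)

  boundedRise-below : ∀ {d e} → StrictlyBelow n d a → BoundedRise i d e → StrictlyBelow n e b
  boundedRise-below {d} {e} (le , j , jn , lt) (rise-other , rise-i) = below , strict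
    where
    below : ∀ m → m ≤ n → height e m ≤ℤ height b m
    below m m≤n with m N.≟ i
    ... | yes refl = ZP.≤-trans rise-i (ZP.≤-trans (ZP.+-monoˡ-≤ (+ 2) (le i m≤n)) (ZP.≤-reflexive (sym hb-i)))
    ... | no mi    = ZP.≤-trans (rise-other m mi) (ZP.≤-trans (le m m≤n) (ZP.≤-reflexive (sym (hb-eq m m≤n mi))))
    strict : Σ ℕ (λ j → (j ≤ n) × (height e j <ℤ height b j))
    strict with j N.≟ i
    ... | yes refl = j , jn , ZP.≤-<-trans rise-i (subst (height d j ⊕ + 2 <ℤ_) (sym hb-i) (ZP.+-monoˡ-< (+ 2) lt))
    ... | no ji    = j , jn , ZP.≤-<-trans (rise-other j ji) (subst (height d j <ℤ_) (sym (hb-eq j jn ji)) lt)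

  σa-i : σ a i ≡ -1ℤ
  σa-i = σ-descent a i i1 (proj₁ (proj₂ (proj₂ mn)))

  σa-suc-i : σ a (suc i) ≡ + 1
  σa-suc-i = σ-ascent a i (proj₂ (proj₂ (proj₂ mn)))

  σb-i : σ b i ≡ + 1
  σb-i = raised-step a b i i1 hb-pred-i hb-i σa-i

  σb-eq : ∀ j → j ≤ n → j ≢ i → j ≢ suc i → σ b j ≡ σ a j
  σb-eq zero    _  _  _   = trans (cong (stepVal 0) (at-zero b)) (sym (cong (stepVal 0) (at-zero a)))
  σb-eq (suc j') jn ji jsi =
    ⊕-cancelˡ (height b j') _ _ (trans (hb-eq (suc j') jn ji)
      (cong (_⊕ σ a (suc j')) (sym (hb-eq j' (NP.≤-trans (NP.n≤1+n j') jn) (λ h → jsi (cong suc h))))))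

-- Here
-- i closes an arch from x < i and i+1 opens one to y > i+1 (or is a string);
-- the rewiring pairs {x, y} and {i, i+1}.  The identification is an instance
-- of pairing-from-arches, comparing arches of a with arches in the heights of b.

module MinimumRewiring {n i a b e} (HA : HalfDiagram n a) (HB : HalfDiagram n b) (mn : MinAt n a i)
                       (dmd : IsDiamond n i a b) (R : Rewiring i a e) where
  open BoxAddition mn dmd
  open Rewiring R
  PA = halfDiagram⇒pairing HA
  PB = halfDiagram⇒pairing HB
  PE = rewiring-pairing PA i1 in' R
  module A = PairingProps PA
  module B = PairingProps PB
  module LA = HalfDiagramArches HA
  module LB = HalfDiagramArches HB
  ha = height a
  hb = height b

  xP : Σ ℕ λ x → at a i ≡ just x × x < i
  xP = A.closing-partner i σa-i

  x : ℕ
  x = proj₁ xP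

  ax : at a i ≡ just x
  ax = proj₁ (proj₂ xP)

  x<i : x < i
  x<i = proj₂ (proj₂ xP)

  y-right : ∀ {y} → at a (suc i) ≡ just y → suc i < y
  y-right {y} e2 with NP.<-cmp (suc i) y
  ... | tri< p _ _ = p
  ... | tri≈ _ p _ = ⊥-elim (A.partner-≢ e2 (sym p))
  ... | tri> _ _ p = ⊥-elim (+1≢-1 (trans (sym σa-suc-i) (σ-closing a (suc i) y e2 (NP.<⇒≤ p))))

  cap-arch : Arch hb i (suc i)
  cap-arch = i1 , NP.n<1+n i , ends , above
    where
    ends : hb (i ∸ 1) ≡ hb (suc i)
    ends = trans hb-pred-i (trans (valley-ends a i i1 σa-i σa-suc-i) (sym (hb-eq (suc i) in' (suc≢ i))))
    above : ∀ m → i ≤ m → m < suc i → hb (suc i) <ℤ hb m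
    above m im ms with NP.≤-antisym im (NP.≤-pred ms)
    ... | refl = subst (_<ℤ hb i) (sym (trans (hb-eq (suc i) in' (suc≢ i)) (cong (ha i ⊕_) σa-suc-i)))
                   (subst (ha i ⊕ + 1 <ℤ_) (sym hb-i) (+1<+2 (ha i)))

  suc-pred : ∀ k → 1 ≤ k → suc (k ∸ 1) ≡ k
  suc-pred (suc k) _ = refl

  arch-kept : ∀ k j → Arch ha k j → k ≢ suc i → j ≢ i → j ≤ n → Arch hb k j
  arch-kept k j (k1 , kj , ends , above) ksi ji jn = k1 , kj , ends' , above'
    where
    k1i : k ∸ 1 ≢ i
    k1i h = ksi (trans (sym (suc-pred k k1)) (cong suc h))
    ends' : hb (k ∸ 1) ≡ hb j
    ends' = trans (hb-eq (k ∸ 1) (NP.≤-trans (NP.m∸n≤m k 1) (NP.≤-trans (NP.<⇒≤ kj) jn)) k1i)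
                  (trans ends (sym (hb-eq j jn ji)))
    above' : ∀ m → k ≤ m → m < j → hb j <ℤ hb m
    above' m km mj = subst (_<ℤ hb m) (sym (hb-eq j jn ji))
                       (ZP.<-≤-trans (above m km mj) (a≤b m (NP.≤-trans (NP.<⇒≤ mj) jn)))

  -- the joined pair {x, y} is an arch of b: it glues the arches x–i and (i+1)–y
  joined-arch : ∀ y → at a y ≡ just (suc i) → Arch hb x y
  joined-arch y ay = A.partner-pos ax , x<y , ends , above
    where
    left = LA.pair-arch i x ax x<i
    i+1<y : suc i < y
    i+1<y = y-right (A.partner-sym ay)
    right = LA.pair-arch y (suc i) ay i+1<y
    yn : y ≤ n
    yn = A.point-≤n ay
    y≢i : y ≢ i
    y≢i h = NP.<-irrefl (sym h) (NP.<-trans (NP.n<1+n i) i+1<y)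
    x<y : x < y
    x<y = NP.<-trans x<i (NP.<-trans (NP.n<1+n i) i+1<y)
    hby : hb y ≡ ha i
    hby = trans (hb-eq y yn y≢i) (sym (proj₁ (proj₂ (proj₂ right))))
    ends : hb (x ∸ 1) ≡ hb y
    ends = trans (hb-eq (x ∸ 1) (NP.≤-trans (NP.m∸n≤m x 1) (NP.≤-trans (NP.<⇒≤ x<i) i≤n))
                        (λ h → NP.<-irrefl h (NP.≤-<-trans (NP.m∸n≤m x 1) x<i)))
                 (trans (proj₁ (proj₂ (proj₂ left))) (sym hby))
    above : ∀ m → x ≤ m → m < y → hb y <ℤ hb m
    above m xm my with NP.<-cmp m i
    ... | tri< m<i _ _ = subst (_<ℤ hb m) (sym hby)
                           (ZP.<-≤-trans (proj₂ (proj₂ (proj₂ left)) m xm m<i) (a≤b m (NP.≤-trans (NP.<⇒≤ m<i) i≤n)))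
    ... | tri≈ _ refl _ = subst (_<ℤ hb m) (sym hby) (subst (ha m <ℤ_) (sym hb-i) (<+2 (ha m)))
    ... | tri> _ _ i<m = subst (_<ℤ hb m) (sym (hb-eq y yn y≢i))
                           (ZP.<-≤-trans (proj₂ (proj₂ (proj₂ right)) m i<m my) (a≤b m (NP.≤-trans (NP.<⇒≤ my) yn)))

  rewired-arch : ∀ j k → at e j ≡ just k → k < j → Arch hb k j
  rewired-arch j k ej kj with j N.≟ i | j N.≟ suc i
  ... | yes refl | _ = ⊥-elim (NP.<-asym (NP.n<1+n j) (subst (_< j) (sym (at-functional {e} at-i ej)) kj))
  ... | no _ | yes refl with at-functional {e} at-suc-i ej
  ...   | refl = cap-arch
  rewired-arch j k ej kj | no ji | no jsi with Maybe-≟ (at a j) (just i) | Maybe-≟ (at a j) (just (suc i))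
  ... | yes aj | _ = ⊥-elim (NP.<-asym (NP.<-trans (NP.n<1+n i) (y-right a-suc-i)) (NP.<-trans (subst (k <_) j≡x kj) x<i))
    where
    j≡x : j ≡ x
    j≡x = A.partner-unique (A.partner-sym aj) ax
    a-suc-i : at a (suc i) ≡ just k
    a-suc-i = trans (sym (mate-of-i j ji jsi aj)) ej
  ... | no _ | yes aj with A.partner-unique ax (trans (sym (mate-of-suc-i j ji jsi aj)) ej)
  ...   | refl = joined-arch j aj
  rewired-arch j k ej kj | no ji | no jsi | no n1 | no n2 = arch-kept k j (LA.pair-arch j k aj kj) k≢si ji (A.point-≤n aj)
    where
    aj : at a j ≡ just k
    aj = trans (sym (elsewhere j ji jsi n1 n2)) ej
    k≢si : k ≢ suc i
    k≢si refl = n2 (A.partner-sym (A.partner-sym aj))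

  closes-in-e : ∀ j → σ b j ≡ -1ℤ → σ e j ≡ -1ℤ
  closes-in-e j σbj with j N.≟ i | j N.≟ suc i
  ... | yes refl | _ = ⊥-elim (+1≢-1 (trans (sym σb-i) σbj))
  ... | no _ | yes refl = σ-closing e j i at-suc-i (NP.n≤1+n i)
  ... | no ji | no jsi with A.closing-partner j (trans (sym (σb-eq j (B.closing-≤n j σbj) ji jsi)) σbj)
  ...   | k , aj , kj with Maybe-≟ (at a j) (just i) | Maybe-≟ (at a j) (just (suc i))
  ...     | yes aji | _ = ⊥-elim (NP.<-asym x<i (subst (i <_) (A.partner-unique (A.partner-sym aji) ax)
                            (subst (_< j) (A.partner-unique aj aji) kj)))
  ...     | no _ | yes ajsi = σ-closing e j x (trans (mate-of-suc-i j ji jsi ajsi) ax)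
                               (NP.<⇒≤ (NP.<-trans x<i (NP.<-trans (NP.n<1+n i) (y-right (A.partner-sym ajsi)))))
  ...     | no n1 | no n2 = σ-closing e j k (trans (elsewhere j ji jsi n1 n2) aj) (NP.<⇒≤ kj)

  rewiring≡diamond : e ≡ b
  rewiring≡diamond = sym (pairing-from-arches PB PE LB.pair-arch rewired-arch closes-in-e)

-- The minimal diagram (1, …, 1): pairs {1,2}, …, {2p−1, 2p}, then strings.
-- It is a half-diagram because every pair is a cap {2m−1, 2m}, which nothing
-- can lie strictly inside.

at-map-applyUpTo : ∀ n (f : ℕ → ℕ) (g : ℕ → Maybe ℕ) k → k < n → at (map g (applyUpTo f n)) (suc k) ≡ g (f k)
at-map-applyUpTo (suc n) f g zero    _        = refl
at-map-applyUpTo (suc n) f g (suc k) (s≤s kn) = at-map-applyUpTo n (λ z → f (suc z)) g k kn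

pairMate-pos : ∀ i → 1 ≤ i → 1 ≤ pairMate i
pairMate-pos (suc zero)          _ = s≤s z≤n
pairMate-pos (suc (suc zero))    _ = s≤s z≤n
pairMate-pos (suc (suc (suc k))) _ = s≤s z≤n

pairMate-involutive : ∀ i → 1 ≤ i → pairMate (pairMate i) ≡ i
pairMate-involutive (suc zero)          _ = refl
pairMate-involutive (suc (suc zero))    _ = refl
pairMate-involutive (suc (suc (suc k))) _ with pairMate (suc k) | pairMate-pos (suc k) (s≤s z≤n) | pairMate-involutive (suc k) (s≤s z≤n)
... | suc m | _ | inv = cong (λ z → 2 + z) inv

pairMate-≢ : ∀ i → 1 ≤ i → pairMate i ≢ i
pairMate-≢ (suc (suc (suc k))) _ h = pairMate-≢ (suc k) (s≤s z≤n) (NP.suc-injective (NP.suc-injective h))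

pairMate-≤ : ∀ i → pairMate i ≤ suc i
pairMate-≤ zero                = z≤n
pairMate-≤ (suc zero)          = NP.≤-refl
pairMate-≤ (suc (suc zero))    = s≤s z≤n
pairMate-≤ (suc (suc (suc k))) = s≤s (s≤s (pairMate-≤ (suc k)))

2*suc : ∀ p → 2 * suc p ≡ suc (suc (2 * p))
2*suc p = cong suc (NP.+-suc p (p + 0))

pairMate-bound : ∀ p i → 1 ≤ i → i ≤ 2 * p → pairMate i ≤ 2 * p
pairMate-bound (suc p) (suc zero)       _ _ = subst (2 ≤_) (sym (2*suc p)) (s≤s (s≤s z≤n))
pairMate-bound (suc p) (suc (suc zero)) _ _ = subst (1 ≤_) (sym (2*suc p)) (s≤s z≤n)
pairMate-bound (suc p) (suc (suc (suc k))) _ h =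
  subst (pairMate (suc (suc (suc k))) ≤_) (sym (2*suc p))
    (s≤s (s≤s (pairMate-bound p (suc k) (s≤s z≤n) (NP.≤-pred (NP.≤-pred (subst (suc (suc (suc k)) ≤_) (2*suc p) h))))))

minEntry-just : ∀ p i j → minEntry p i ≡ just j → (i < suc (2 * p)) × (pairMate i ≡ j)
minEntry-just p i j h with i <ᵇ suc (2 * p) in eb
... | true  = NP.<ᵇ⇒< i _ (subst T (sym eb) tt) , MP.just-injective h
... | false = ⊥-elim (nothing≢just h)

minimal-halfDiagram : ∀ n p → 2 * p ≤ n → HalfDiagram n (minimalDiagram n p)
minimal-halfDiagram n p pn = record { len = len ; pairing = pairing ; noncross = noncross ; noncrossTS = noncrossTS }
  where
  M = minimalDiagram n p
  len : length M ≡ n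
  len = trans (LP.length-map _ (upTo n)) (LP.length-applyUpTo (λ z → z) n)
  atM : ∀ j → 1 ≤ j → j ≤ n → at M j ≡ minEntry p j
  atM (suc k) _ kn = at-map-applyUpTo n (λ z → z) (λ k → minEntry p (suc k)) k kn
  pairs : ∀ i j → at M i ≡ just j → (1 ≤ i) × (i ≤ 2 * p) × (pairMate i ≡ j)
  pairs i j e with at-just-range M i j e
  ... | i1 , iL with minEntry-just p i j (trans (sym (atM i i1 (subst (i ≤_) len iL))) e)
  ...   | ip , pe = i1 , NP.≤-pred ip , pe
  pairing : ∀ i j → at M i ≡ just j → (1 ≤ j) × (j ≤ n) × (j ≢ i) × (at M j ≡ just i)
  pairing i j e with pairs i j e
  ... | i1 , ip , refl = pairMate-pos i i1 , NP.≤-trans mate≤ pn , pairMate-≢ i i1 ,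
        trans (atM (pairMate i) (pairMate-pos i i1) (NP.≤-trans mate≤ pn))
              (trans (cong (λ c → if c then just (pairMate (pairMate i)) else nothing)
                       (<ᵇ-true (pairMate i) (suc (2 * p)) (s≤s mate≤)))
                     (cong just (pairMate-involutive i i1)))
    where
    mate≤ = pairMate-bound p i i1 ip
  nothing-inside : ∀ i j k → at M i ≡ just j → i < k → k < j → ⊥
  nothing-inside i j k e ik kj with pairs i j e
  ... | _ , _ , refl = NP.<-irrefl refl (NP.<-≤-trans kj (NP.≤-trans (pairMate-≤ i) ik))
  noncross : ∀ i j k l → at M i ≡ just j → at M k ≡ just l → i < k → k < j → j < l → ⊥
  noncross i j k l e _ ik kj _ = nothing-inside i j k e ik kj
  noncrossTS : ∀ i j k → at M i ≡ just j → i < k → k < j → at M k ≡ nothing → ⊥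
  noncrossTS i j k e ik kj _ = nothing-inside i j k e ik kj

Admissible : ℕ → Raw → Raw → Set
Admissible n a d = Pairing n d × (d ≡ a ⊎ StrictlyBelow n d a)

TwoStrings : ℕ → Raw → Set
TwoStrings i d = at d i ≡ nothing × at d (suc i) ≡ nothing

module Coefficients {c ℓ} (R : CommutativeRing c ℓ) (q : CommutativeRing.Carrier R)
                    (inv : ℕ → CommutativeRing.Carrier R) where
  open CommutativeRing R using (Carrier; _≈_; 0#; 1#; +-cong; +-assoc; +-identityˡ; +-identityʳ; *-identityʳ; reflexive)
    renaming (_+_ to _+R_; _*_ to _*R_; refl to ≈-refl; sym to ≈-sym; trans to ≈-trans)
  open TL R q inv

  AllTerms : (Raw → Set) → LC → Set c
  AllTerms P = All (λ t → P (proj₂ t))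

  coeff-match : ∀ d a (x : Carrier) → d ≡ a → (if does (d ≟R a) then x else 0#) ≡ x
  coeff-match d a x p rewrite dec-true (d ≟R a) p = refl

  coeff-mismatch : ∀ d a (x : Carrier) → d ≢ a → (if does (d ≟R a) then x else 0#) ≡ 0#
  coeff-mismatch d a x p rewrite dec-false (d ≟R a) p = refl

  coeff-++ : ∀ a v w → coeff a (v ++ w) ≈ coeff a v +R coeff a w
  coeff-++ a []            w = ≈-sym (+-identityˡ _)
  coeff-++ a ((x , d) ∷ v) w = ≈-trans (+-cong ≈-refl (coeff-++ a v w)) (≈-sym (+-assoc _ _ _))

  coeff-absent : ∀ a v → AllTerms (_≢ a) v → coeff a v ≈ 0#
  coeff-absent a []            All.[] = ≈-refl
  coeff-absent a ((x , d) ∷ v) (ne All.∷ ps) =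
    ≈-trans (+-cong (reflexive (coeff-mismatch d a x ne)) (coeff-absent a v ps)) (+-identityˡ 0#)

  scale-terms : ∀ {P : Raw → Set} s v → AllTerms P v → AllTerms P (scale s v)
  scale-terms s v ps = AllP.map⁺ ps

  eBasis-shape : ∀ {n i d} → Pairing n d → 1 ≤ i → suc i ≤ n →
                 AllTerms (λ e → e ≡ d ⊎ (Rewiring i d e × ¬ TwoStrings i d)) (eBasis i d)
  eBasis-shape {n} {i} {d} P i1 in' with at d i in e1 | at d (suc i) in e2
  ... | nothing | nothing = All.[]
  ... | nothing | just y  = inj₂ (RewiringShapes.rewire-string-pair P i1 in' e1 e2 , λ s → nothing≢just (sym (proj₂ s))) All.∷ All.[]
  ... | just x  | nothing = inj₂ (RewiringShapes.rewire-pair-string P i1 in' e1 e2 , λ s → nothing≢just (sym (proj₁ s))) All.∷ All.[]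
  ... | just x  | just y with x N.≟ suc i
  ...   | yes _ = inj₁ refl All.∷ All.[]
  ...   | no ne = inj₂ (RewiringShapes.rewire-pair-pair P i1 in' e1 e2 ne , λ s → nothing≢just (sym (proj₁ s))) All.∷ All.[]

  eBasis-closing : ∀ {n i d x} → Pairing n d → 1 ≤ i → suc i ≤ n → at d i ≡ just x → x < i →
                   Σ Raw λ e → (eBasis i d ≡ (1# , e) ∷ []) × Rewiring i d e
  eBasis-closing {n} {i} {d} {x} P i1 in' ex x<i with at d i in e1 | at d (suc i) in e2
  ... | nothing | _ = ⊥-elim (nothing≢just ex)
  ... | just x' | nothing = _ , refl , RewiringShapes.rewire-pair-string P i1 in' e1 e2
  ... | just x' | just y with x' N.≟ suc i
  ...   | yes refl = ⊥-elim (NP.<-asym (NP.n<1+n i) (subst (_< i) (sym (MP.just-injective ex)) x<i))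
  ...   | no ne    = _ , refl , RewiringShapes.rewire-pair-pair P i1 in' e1 e2 ne

  module BoxStep {n i a b} (HA : HalfDiagram n a) (HB : HalfDiagram n b) (mn : MinAt n a i) (dmd : IsDiamond n i a b) where
    open BoxAddition mn dmd
    PA = halfDiagram⇒pairing HA

    eBasis-a : eBasis i a ≡ (1# , b) ∷ []
    eBasis-a with A.closing-partner i σa-i
      where module A = PairingProps PA
    ... | x , ax , x<i with eBasis-closing PA i1 in' ax x<i
    ...   | e , eq , R = trans eq (cong (λ z → (1# , z) ∷ []) (MinimumRewiring.rewiring≡diamond HA HB mn dmd R))

    below-step : ∀ {d} → StrictlyBelow n d a → Pairing n d →
                 AllTerms (λ e → Pairing n e × StrictlyBelow n e b) (eBasis i d)
    below-step {d} bl P = All.map image (eBasis-shape P i1 in')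
      where
      image : ∀ {e} → e ≡ d ⊎ (Rewiring i d e × ¬ TwoStrings i d) → Pairing n e × StrictlyBelow n e b
      image (inj₁ refl)         = P , below-a⇒below-b bl
      image (inj₂ (R , nottwo)) = rewiring-pairing P i1 in' R ,
                                 boundedRise-below bl (RewiringHeights.rewiring-boundedRise P i1 R nottwo)

    eAct-admissible : ∀ v → AllTerms (Admissible n a) v → AllTerms (Admissible n b) (eAct i v)
    eAct-admissible [] All.[] = All.[]
    eAct-admissible ((x , d) ∷ v) ((P , inj₁ refl) All.∷ ps) rewrite eBasis-a =
      (halfDiagram⇒pairing HB , inj₁ refl) All.∷ eAct-admissible v ps
    eAct-admissible ((x , d) ∷ v) ((P , inj₂ bl) All.∷ ps) =
      AllP.++⁺ (scale-terms x (eBasis i d) (All.map (λ { (P' , bl') → P' , inj₂ bl' }) (below-step bl P)))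
               (eAct-admissible v ps)

    scale-admissible : ∀ s v → AllTerms (Admissible n a) v → AllTerms (Admissible n b) (scale s v)
    scale-admissible s v ps = scale-terms s v (All.map raise ps)
      where
      raise : ∀ {d} → Admissible n a d → Admissible n b d
      raise (P , inj₁ refl) = P , inj₂ a-below-b
      raise (P , inj₂ bl)   = P , inj₂ (below-a⇒below-b bl)

    admissible-≢b : ∀ v → AllTerms (Admissible n a) v → AllTerms (_≢ b) v
    admissible-≢b v = All.map λ { (_ , inj₁ refl) → strictlyBelow⇒≢ a-below-b ; (_ , inj₂ bl) → strictlyBelow⇒≢ (below-a⇒below-b bl) }

    eAct-coeff : ∀ v → AllTerms (Admissible n a) v → coeff b (eAct i v) ≈ coeff a v
    eAct-coeff [] All.[] = ≈-refl
    eAct-coeff ((x , d) ∷ v) ((P , inj₁ refl) All.∷ ps) rewrite eBasis-a =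
      +-cong (≈-trans (reflexive (coeff-match b b (x *R 1#) refl))
                      (≈-trans (*-identityʳ x) (reflexive (sym (coeff-match a a x refl)))))
             (eAct-coeff v ps)
    eAct-coeff ((x , d) ∷ v) ((P , inj₂ bl) All.∷ ps) =
      ≈-trans (coeff-++ b (scale x (eBasis i d)) (eAct i v))
        (+-cong (≈-trans (coeff-absent b _ (scale-terms x (eBasis i d) (All.map (λ { (_ , bl') → strictlyBelow⇒≢ bl' }) (below-step bl P))))
                         (reflexive (sym (coeff-mismatch d a x (strictlyBelow⇒≢ bl)))))
                (eAct-coeff v ps))

  xiPrime-invariant : ∀ {n p a v} → 2 * p ≤ n → XiPrime n p a v →
                      HalfDiagram n a × AllTerms (Admissible n a) v × (coeff a v ≈ 1#)
  xiPrime-invariant {n} {p} pn base =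
    H , (halfDiagram⇒pairing H , inj₁ refl) All.∷ All.[] ,
    ≈-trans (+-cong (reflexive (coeff-match M M 1# refl)) ≈-refl) (+-identityʳ 1#)
    where
    M = minimalDiagram n p
    H = minimal-halfDiagram n p pn
  xiPrime-invariant {n} {p} {b} pn (step {a} {v} i ξ mn dmd) with xiPrime-invariant pn ξ
  ... | HA , adm , coeff≈1 =
    HB , AllP.++⁺ (S.eAct-admissible v adm) (S.scale-admissible _ v adm) ,
    ≈-trans (coeff-++ b (eAct i v) _)
      (≈-trans (+-cong (S.eAct-coeff v adm) (coeff-absent b _ (scale-terms _ v (S.admissible-≢b v adm))))
        (≈-trans (+-identityʳ _) coeff≈1))
    where
    HB = proj₁ dmd
    module S = BoxStep HA HB mn dmd

mainTheorem3 : ∀ {c ℓ} (R : CommutativeRing c ℓ) (q : CommutativeRing.Carrier R)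
               (inv : ℕ → CommutativeRing.Carrier R) (n p : ℕ) →
               (∀ k → k ≤ n → CommutativeRing._≈_ R (CommutativeRing._*_ R (TL.Δ R q inv k) (inv k)) (CommutativeRing.1# R)) →
               2 * p ≤ n →
               ∀ (a : Raw) (v : TL.LC R q inv) →
               HalfDiagram n a → numPairs n a ≡ p →
               TL.XiPrime R q inv n p a v →
               CommutativeRing._≈_ R (TL.coeff R q inv a v) (CommutativeRing.1# R)
mainTheorem3 R q inv n p _ 2p≤n a v _ _ ξ' = proj₂ (proj₂ (Coefficients.xiPrime-invariant R q inv 2p≤n ξ'))
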